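{- Let $N=(\Gamma,B)$ be a network and assign a distinct color to each boundary node. For any integer $k\ge|B|$, $\bar\chi_{M(N)}(k)$ is the number of proper colorings of $\Gamma$ with $k$ colors (containing the assigned colors) that agree with the given assignment on $B$.
   Context: A network $N=(\Gamma,B)$ consists of a finite connected graph $\Gamma=(V,E)$ with no loops or multiple edges and a set $B\subsetneq V$ of at least 2 vertices (boundary nodes), no two of which are adjacent; vertices in $V\setminus B$ are interior. The Dirichlet matroid $M(N)$: fix an injective $u:B\to\mathbb{R}$ and a new symbol $e_0\notin E$; in $\mathbb{R}^{(V\setminus B)\cup\{0\}}$ assign to each edge $ij$ with $i,j$ interior the vector $\mathbf{e}_i-\mathbf{e}_j$, to each edge $ij$ with $i$ interior and $j\in B$ the vector $\mathbf{e}_i-u(j)\mathbf{e}_0$, and to $e_0$ the vector $\mathbf{e}_0$; $M(N)$ is the matroid of linear independence of these vectors on $E\cup\{e_0\}$. $\bar\chi_{M(N)}(\lambda)=\chi_{M(N)}(\lambda)/(\lambda-1)$ is the reduced characteristic polynomial of $M(N)$ (the precoloring polynomial of $N$). -}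

module Defs where

open import Level using (Level; _⊔_) renaming (suc to lsuc)
open import Data.Nat using (ℕ; zero; suc; _∸_; _≤_)
open import Data.Bool using (Bool; true; false; if_then_else_; not)
open import Data.Fin using (Fin; zero; suc; _≟_)
open import Data.Fin.Subset using (Subset; inside; outside; ⊤; _⊆_; ∣_∣)
open import Data.Vec using (Vec; []; _∷_; lookup; tabulate)
open import Data.List using (List; []; _∷_; map; concatMap; length; filterᵇ; foldr; allFin)
open import Data.Maybe using (Maybe; just; nothing)
open import Data.Product using (_×_; _,_; proj₁; proj₂; ∃; ∃-syntax)
open import Data.Sum using (_⊎_)
open import Data.Integer as ℤ using (ℤ; +_; -_)
open import Relation.Nullary using (¬_; does)
open import Relation.Binary.PropositionalEquality using (_≡_; _≢_)
open import Algebra.Bundles using (CommutativeRing)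

SameEnds : ∀ {n} → Fin n × Fin n → Fin n × Fin n → Set
SameEnds (a , b) (c , d) = (a ≡ c × b ≡ d) ⊎ (a ≡ d × b ≡ c)

Adjacent : ∀ {n m} → (Fin m → Fin n × Fin n) → Fin n → Fin n → Set
Adjacent ends v w = ∃[ e ] SameEnds (ends e) (v , w)

data Walk {n m} (ends : Fin m → Fin n × Fin n) : Fin n → Fin n → Set where
  [] : ∀ {v} → Walk ends v v
  _∷_ : ∀ {u v w} → Adjacent ends u v → Walk ends v w → Walk ends u w

record Network : Set where
  field
    n m       : ℕ
    ends      : Fin m → Fin n × Fin n
    loopless  : ∀ e → proj₁ (ends e) ≢ proj₂ (ends e)
    simple    : ∀ e e′ → SameEnds (ends e) (ends e′) → e ≡ e′
    connected : ∀ v w → Walk ends v w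
    isB       : Fin n → Bool
    twoBoundary : ∃[ v ] ∃[ w ] (v ≢ w × isB v ≡ true × isB w ≡ true)
    someInterior : ∃[ v ] isB v ≡ false
    boundaryIndep : ∀ e → ¬ (isB (proj₁ (ends e)) ≡ true × isB (proj₂ (ends e)) ≡ true)

Bset : (N : Network) → Subset (Network.n N)
Bset N = tabulate (Network.isB N)

record Field (c ℓ : Level) : Set (lsuc (c ⊔ ℓ)) where
  field
    commutativeRing : CommutativeRing c ℓ
  open CommutativeRing commutativeRing public
  field
    0≉1     : ¬ (0# ≈ 1#)
    inverse : ∀ x → ¬ (x ≈ 0#) → ∃[ y ] (x * y ≈ 1#)

-- Ground set: Fin (suc m); zero is e₀, suc e is the edge e.
-- Coordinates: Maybe (Fin n); nothing is the coordinate 0, just i is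
-- the coordinate of vertex i (boundary coordinates are never used, i.e.
-- identically zero, which does not affect linear independence).

module DirichletMatroid {c ℓ} (N : Network) (F : Field c ℓ)
                        (u : Fin (Network.n N) → Field.Carrier F) where
  open Network N
  open Field F using (Carrier; _≈_; _+_; _*_; _-_; 0#; 1#)

  Coord : Set
  Coord = Maybe (Fin n)

  δ : Coord → Coord → Carrier
  δ nothing  nothing  = 1#
  δ (just i) (just j) = if does (i ≟ j) then 1# else 0#
  δ nothing  (just _) = 0#
  δ (just _) nothing  = 0#

  -- vector of edge ij with i interior: e_i − e_j (j interior) or
  -- e_i − u(j) e_0 (j boundary)
  edgeVec′ : Fin n → Fin n → Coord → Carrier
  edgeVec′ i j x = δ (just i) x - (if isB j then u j * δ nothing x else δ (just j) x)

  edgeVec : Fin n × Fin n → Coord → Carrier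
  edgeVec (a , b) = if isB a then edgeVec′ b a else edgeVec′ a b

  vec : Fin (suc m) → Coord → Carrier
  vec zero    = δ nothing
  vec (suc e) = edgeVec (ends e)

  sumFin : ∀ {k} → (Fin k → Carrier) → Carrier
  sumFin {zero}  f = 0#
  sumFin {suc k} f = f zero + sumFin (λ i → f (suc i))

  Independent : Subset (suc m) → Set (c ⊔ ℓ)
  Independent S =
    ∀ (coef : Fin (suc m) → Carrier) →
    (∀ x → sumFin (λ g → if lookup S g then coef g * vec g x else 0#) ≈ 0#) →
    ∀ g → lookup S g ≡ true → coef g ≈ 0#

  IsRank : Subset (suc m) → ℕ → Set (c ⊔ ℓ)
  IsRank S r =
    (∃[ T ] (T ⊆ S × Independent T × ∣ T ∣ ≡ r)) ×
    (∀ T → T ⊆ S → Independent T → ∣ T ∣ ≤ r)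

sumSubsets : ∀ k → (Subset k → ℤ) → ℤ
sumSubsets zero    f = f []
sumSubsets (suc k) f = sumSubsets k (λ S → f (outside ∷ S)) ℤ.+ sumSubsets k (λ S → f (inside ∷ S))

charPolyAt : ∀ g → (ρ : Subset g → ℕ) → ℕ → ℤ
charPolyAt g ρ k = sumSubsets g (λ S → ((- (+ 1)) ℤ.^ ∣ S ∣) ℤ.* ((+ k) ℤ.^ (ρ ⊤ ∸ ρ S)))

allᵇ : ∀ {A : Set} → (A → Bool) → List A → Bool
allᵇ p = foldr (λ x b → if p x then b else false) true

allVecs : ∀ k n → List (Vec (Fin k) n)
allVecs k zero    = [] ∷ []
allVecs k (suc n) = concatMap (λ x → map (x ∷_) (allVecs k n)) (allFin k)

numColorings : (N : Network) → (k : ℕ) → (Fin (Network.n N) → Fin k) → ℕ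
numColorings N k col = length (filterᵇ good (allVecs k n))
  where
  open Network N
  proper : Vec (Fin k) n → Bool
  proper κ = allᵇ (λ e → not (does (lookup κ (proj₁ (ends e)) ≟ lookup κ (proj₂ (ends e))))) (allFin m)
  agrees : Vec (Fin k) n → Bool
  agrees κ = allᵇ (λ v → if isB v then does (lookup κ v ≟ col v) else true) (allFin n)
  good : Vec (Fin k) n → Bool
  good κ = if proper κ then agrees κ else false

module Submission where

-- Write ~_A for connectivity in (V, A), A ⊆ E.  A is *bad* if it connects
-- two distinct boundary nodes, and a component of A is *free* if it has no
-- boundary node.  The proof has three independent parts.
--  1. Rank formula (RankFormula): r(A) = I − c₀(A) + [A bad] and
--     r(A + e₀) = I − c₀(A) + 1, where I = #interior nodes and c₀(A) =
--     #free components.  Adding one element either keeps this candidate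
--     fixed and the new vector is in the span, or raises it by one and a
--     functional separates the new vector (Growth); by induction over
--     subsets the candidate is then the size of every maximal independent set.
--  2. Counting (Colourings): the colourings that agree with col on B and are
--     constant on the components of A number 0 if A is bad and k^c₀(A)
--     otherwise; by inclusion–exclusion over A their signed sum counts the
--     proper colourings.
--  3. Assembly (CharacteristicPolynomial): pairing the terms of A and A + e₀
--     in χ(k) = Σ_S (−1)^|S| k^(r(E+e₀) − r(S)), using r(E + e₀) = I + 1
--     (Γ is connected), gives χ(k) = (k − 1) Σ_A (−1)^|A| · #colourings(A).

open import Defs using (Network; Field; module DirichletMatroid; SameEnds; sumSubsets; charPolyAt; allVecs; allᵇ; numColorings; Bset)
open import Level using (Level; _⊔_)
open import Data.Nat using (ℕ; suc; _≤_)
open import Data.Bool using (true)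
open import Data.Fin using (Fin)
open import Data.Fin.Subset using (Subset; ∣_∣)
open import Data.Product using (_×_)
open import Relation.Binary.PropositionalEquality using (_≡_)

module Subsets where

  open import Data.Nat using (ℕ; zero; suc; _+_; _≤_; z≤n)
  open import Data.Nat.Properties using (≤-refl; +-suc; +-mono-≤; +-commutativeSemigroup)
  open import Data.Bool using (Bool; true; false; not; _∧_)
  open import Data.Fin using (Fin; zero; suc)
  open import Data.Fin.Properties using (suc-injective) renaming (_≟_ to _≟ᶠ_)
  open import Data.Fin.Subset using (Subset; ∣_∣)
  open import Data.Vec using ([]; _∷_; lookup; replicate; _[_]≔_)
  open import Data.Vec.Properties using (lookup∘update; lookup∘update′)
  open import Data.Sum using (_⊎_; inj₁; inj₂)
  open import Data.Empty using (⊥-elim)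
  open import Function using (_∘_)
  open import Relation.Nullary using (Dec; yes; no; does)
  open import Relation.Binary.PropositionalEquality using (_≡_; _≢_; refl; sym; trans; cong; cong₂)

  ind : Bool → ℕ
  ind true  = 1
  ind false = 0

  count : ∀ {n} → (Fin n → Bool) → ℕ
  count {zero}  p = 0
  count {suc n} p = ind (p zero) + count (p ∘ suc)

  count-ext : ∀ {n} (p q : Fin n → Bool) → (∀ i → p i ≡ q i) → count p ≡ count q
  count-ext {zero}  p q h = refl
  count-ext {suc n} p q h = cong₂ _+_ (cong ind (h zero)) (count-ext (p ∘ suc) (q ∘ suc) (h ∘ suc))

  ind-mono : ∀ {a b} → (a ≡ true → b ≡ true) → ind a ≤ ind b
  ind-mono {false} h = z≤n
  ind-mono {true} {true} h = ≤-refl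
  ind-mono {true} {false} h with h refl
  ... | ()

  count-mono : ∀ {n} (p q : Fin n → Bool) → (∀ i → p i ≡ true → q i ≡ true) → count p ≤ count q
  count-mono {zero}  p q h = z≤n
  count-mono {suc n} p q h = +-mono-≤ (ind-mono (h zero)) (count-mono (p ∘ suc) (q ∘ suc) (h ∘ suc))

  count-flip : ∀ {n} (p q : Fin n → Bool) (i₀ : Fin n) → p i₀ ≡ false → q i₀ ≡ true →
               (∀ i → i ≢ i₀ → p i ≡ q i) → count q ≡ suc (count p)
  count-flip {suc n} p q zero pf qt h rewrite pf | qt =
    cong suc (sym (count-ext (p ∘ suc) (q ∘ suc) (λ i → h (suc i) (λ ()))))
  count-flip {suc n} p q (suc i₀) pf qt h =
    trans (cong₂ _+_ (sym (cong ind (h zero (λ ()))))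
                     (count-flip (p ∘ suc) (q ∘ suc) i₀ pf qt (λ i ne → h (suc i) (ne ∘ suc-injective))))
          (+-suc (ind (p zero)) (count (p ∘ suc)))

  ind-split : ∀ a b → ind a ≡ ind (a ∧ b) + ind (a ∧ not b)
  ind-split false b     = refl
  ind-split true  false = refl
  ind-split true  true  = refl

  count-split : ∀ {n} (p q : Fin n → Bool) →
                count p ≡ count (λ i → p i ∧ q i) + count (λ i → p i ∧ not (q i))
  count-split {zero}  p q = refl
  count-split {suc n} p q
    rewrite count-split (p ∘ suc) (q ∘ suc) | ind-split (p zero) (q zero) =
      interchange (ind (p zero ∧ q zero)) (ind (p zero ∧ not (q zero))) _ _
    where open import Algebra.Properties.CommutativeSemigroup +-commutativeSemigroup using (interchange)

  does-⇔ : ∀ {a b} {P : Set a} {Q : Set b} → (P → Q) → (Q → P) → (p : Dec P) (q : Dec Q) → does p ≡ does q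
  does-⇔ f g (yes x) (yes y) = refl
  does-⇔ f g (yes x) (no ¬y) = ⊥-elim (¬y (f x))
  does-⇔ f g (no ¬x) (yes y) = ⊥-elim (¬x (g y))
  does-⇔ f g (no ¬x) (no ¬y) = refl

  ∈-insert⁻ : ∀ {m} (A : Subset m) e e′ → lookup (A [ e ]≔ true) e′ ≡ true → e′ ≡ e ⊎ lookup A e′ ≡ true
  ∈-insert⁻ A e e′ h with e′ ≟ᶠ e
  ... | yes eq = inj₁ eq
  ... | no ne  = inj₂ (trans (sym (lookup∘update′ ne A true)) h)

  ∈-insert⁺ : ∀ {m} (A : Subset m) e e′ → lookup A e′ ≡ true → lookup (A [ e ]≔ true) e′ ≡ true
  ∈-insert⁺ A e e′ h with e′ ≟ᶠ e
  ... | yes refl = lookup∘update e′ A true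
  ... | no ne    = trans (lookup∘update′ ne A true) h

  ∣insert∣ : ∀ {m} (A : Subset m) e → lookup A e ≡ false → ∣ A [ e ]≔ true ∣ ≡ suc ∣ A ∣
  ∣insert∣ (false ∷ A) zero    refl = refl
  ∣insert∣ (true  ∷ A) (suc e) l    = cong suc (∣insert∣ A e l)
  ∣insert∣ (false ∷ A) (suc e) l    = ∣insert∣ A e l

  insertion-induction : ∀ {ℓ} {n} (P : Subset n → Set ℓ) → P (replicate n false) →
    (∀ A e → lookup A e ≡ false → P A → P (A [ e ]≔ true)) → ∀ A → P A
  insertion-induction {n = zero} P base step [] = base
  insertion-induction {n = suc n} P base step (b ∷ A) = last b
    where
    rest : P (false ∷ A)
    rest = insertion-induction (λ A → P (false ∷ A)) base (λ A e h p → step (false ∷ A) (suc e) h p) A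
    last : ∀ b → P (b ∷ A)
    last false = rest
    last true  = step (false ∷ A) zero refl rest

module Components where

  open Subsets
  open import Level using (0ℓ)
  open import Data.Nat using (ℕ; zero; suc; _+_; s≤s)
  open import Data.Nat.Properties using (+-comm; <-trans)
  open import Data.Bool using (Bool; true; false; not; _∧_)
  open import Data.Bool.Properties using (∧-zeroʳ) renaming (_≟_ to _≟ᵇ_)
  open import Data.Fin using (Fin; zero; suc; _<_)
  open import Data.Fin.Properties using (any?; all?; _<?_; <-cmp) renaming (_≟_ to _≟ᶠ_)
  open import Data.Product using (_×_; _,_; proj₁; proj₂; ∃)
  open import Data.Sum using (_⊎_; inj₁; inj₂)
  open import Data.Empty using (⊥-elim)
  open import Function using (_∘_)
  open import Relation.Nullary using (¬_; Dec; yes; no; does)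
  open import Relation.Nullary.Decidable using (_×-dec_; _→-dec_; ¬?)
  open import Relation.Binary using (Rel; IsDecEquivalence; tri<; tri≈; tri>)
  open import Relation.Binary.PropositionalEquality using (_≡_; _≢_; refl; sym; trans; cong; subst)

  least : ∀ {n} (P : Fin n → Set) → (∀ v → Dec (P v)) → ∀ v → P v →
          ∃ λ w → P w × (∀ u → u < w → ¬ P u)
  least {suc n} P P? v pv with P? zero
  ... | yes p0 = zero , p0 , λ u ()
  least {suc n} P P? zero    pv | no ¬p0 = ⊥-elim (¬p0 pv)
  least {suc n} P P? (suc v) pv | no ¬p0 with least (P ∘ suc) (P? ∘ suc) v pv
  ... | w , pw , below = suc w , pw , λ where
    zero    _        → ¬p0
    (suc u) (s≤s lt) → below u lt

  module Marked {n : ℕ} (marked : Fin n → Bool) where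

    Free : Rel (Fin n) 0ℓ → Fin n → Set
    Free R v = ∀ w → R v w → marked w ≡ false

    Least : Rel (Fin n) 0ℓ → Fin n → Set
    Least R v = ∀ w → w < v → ¬ R w v

    Rep : Rel (Fin n) 0ℓ → Fin n → Set
    Rep R v = Free R v × Least R v

    Anchored : Rel (Fin n) 0ℓ → Fin n → Set
    Anchored R v = ∃ λ w → marked w ≡ true × R v w

    Bad : Rel (Fin n) 0ℓ → Set
    Bad R = ∃ λ α → ∃ λ β → marked α ≡ true × marked β ≡ true × α ≢ β × R α β

    marked-unique : ∀ {R : Rel (Fin n) 0ℓ} {x y} → ¬ Bad R → marked x ≡ true → marked y ≡ true → R x y → x ≡ y
    marked-unique {x = x} {y} ¬bad mx my r with x ≟ᶠ y
    ... | yes eq = eq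
    ... | no ne  = ⊥-elim (¬bad (x , y , mx , my , ne , r))

    module _ {R : Rel (Fin n) 0ℓ} (E : IsDecEquivalence R) where
      open IsDecEquivalence E using () renaming
        (refl to R-refl; sym to R-sym; trans to R-trans; _≟_ to _R?_)

      free? : ∀ v → Dec (Free R v)
      free? v = all? (λ w → (v R? w) →-dec (marked w ≟ᵇ false))

      least? : ∀ v → Dec (Least R v)
      least? v = all? (λ w → (w <? v) →-dec ¬? (w R? v))

      -- (opaque: only the truth values of these decisions matter, never their
      -- normal forms, which are very large)
      opaque
        rep? : ∀ v → Dec (Rep R v)
        rep? v = free? v ×-dec least? v

        anchored? : ∀ v → Dec (Anchored R v)
        anchored? v = any? (λ w → (marked w ≟ᵇ true) ×-dec (v R? w))

        bad? : Dec (Bad R)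
        bad? = any? λ α → any? λ β →
          (marked α ≟ᵇ true) ×-dec ((marked β ≟ᵇ true) ×-dec (¬? (α ≟ᶠ β) ×-dec (α R? β)))

      nonRep : Fin n → Bool
      nonRep v = not (marked v) ∧ not (does (rep? v))

      -- the number of unmarked elements minus the number of free classes
      deficit : ℕ
      deficit = count nonRep

      freeClasses : ℕ
      freeClasses = count (λ v → does (rep? v))

      free-trans : ∀ {v w} → Free R v → R v w → Free R w
      free-trans fv r x r′ = fv x (R-trans r r′)

      free-unmarked : ∀ {v} → Free R v → marked v ≡ false
      free-unmarked fv = fv _ R-refl

      free⇒¬anchored : ∀ {v} → Free R v → ¬ Anchored R v
      free⇒¬anchored fv (w , mw , r) with trans (sym mw) (fv w r)
      ... | ()

      ¬anchored⇒free : ∀ {v} → ¬ Anchored R v → Free R v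
      ¬anchored⇒free {v} na w r with marked w in eq
      ... | true  = ⊥-elim (na (w , eq , r))
      ... | false = refl

      least-unique : ∀ {x y} → Least R x → Least R y → R x y → x ≡ y
      least-unique {x} {y} lx ly r with <-cmp x y
      ... | tri< lt _ _ = ⊥-elim (ly x lt r)
      ... | tri≈ _ eq _ = eq
      ... | tri> _ _ gt = ⊥-elim (lx y gt (R-sym r))

      private
        leastIn : ∀ v → ∃ λ w → R w v × (∀ u → u < w → ¬ R u v)
        leastIn v = least (λ w → R w v) (λ w → w R? v) v R-refl

      minOf : Fin n → Fin n
      minOf v = proj₁ (leastIn v)

      minOf-R : ∀ v → R (minOf v) v
      minOf-R v = proj₁ (proj₂ (leastIn v))

      minOf-least : ∀ v → Least R (minOf v)
      minOf-least v u lt r = proj₂ (proj₂ (leastIn v)) u lt (R-trans r (minOf-R v))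

      minOf-≤ : ∀ v w → R w v → ¬ (w < minOf v)
      minOf-≤ v w r lt = minOf-least v w lt (R-trans r (R-sym (minOf-R v)))

      minOf-cong : ∀ {v w} → R v w → minOf v ≡ minOf w
      minOf-cong {v} {w} r = least-unique (minOf-least v) (minOf-least w)
        (R-trans (minOf-R v) (R-trans r (R-sym (minOf-R w))))

      minOf-self : ∀ {v} → Least R v → minOf v ≡ v
      minOf-self {v} lv = least-unique (minOf-least v) lv (minOf-R v)

      unmarked-split : count (λ v → not (marked v)) ≡ deficit + freeClasses
      unmarked-split = trans (count-split (not ∘ marked) (does ∘ rep?))
        (trans (+-comm _ deficit) (cong (deficit +_) (count-ext _ _ rep-is-unmarked)))
        where
        rep-is-unmarked : ∀ v → (not (marked v) ∧ does (rep? v)) ≡ does (rep? v)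
        rep-is-unmarked v with rep? v
        ... | yes (fv , _) rewrite free-unmarked fv = refl
        ... | no _ = ∧-zeroʳ (not (marked v))

    module Coarsen {R R′ : Rel (Fin n) 0ℓ} (E : IsDecEquivalence R) (E′ : IsDecEquivalence R′)
                   (R⊆R′ : ∀ {v w} → R v w → R′ v w) where
      open IsDecEquivalence E using () renaming (refl to R-refl; sym to R-sym; trans to R-trans)
      open IsDecEquivalence E′ using () renaming (sym to R′-sym; trans to R′-trans)

      rep-anti : ∀ {v} → Rep R′ v → Rep R v
      rep-anti (fv , lv) = (λ w r → fv w (R⊆R′ r)) , (λ w lt r → lv w lt (R⊆R′ r))

      bad-mono : Bad R → Bad R′
      bad-mono (α , β , mα , mβ , α≢β , r) = α , β , mα , mβ , α≢β , R⊆R′ r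

      deficit-same : (∀ v → Rep R v → Rep R′ v) → deficit E′ ≡ deficit E
      deficit-same keep = count-ext _ _ λ v →
        cong (λ b → not (marked v) ∧ not b) (does-⇔ rep-anti (keep v) (rep? E′ v) (rep? E v))

      deficit-suc : ∀ r → Rep R r → ¬ Rep R′ r → (∀ v → v ≢ r → Rep R v → Rep R′ v) →
                    deficit E′ ≡ suc (deficit E)
      deficit-suc r rep ¬rep′ keep = count-flip (nonRep E) (nonRep E′) r before after
        (λ v v≢r → cong (λ b → not (marked v) ∧ not b) (does-⇔ (keep v v≢r) rep-anti (rep? E v) (rep? E′ v)))
        where
        before : nonRep E r ≡ false
        before with rep? E r
        ... | yes _ = ∧-zeroʳ (not (marked r))
        ... | no ¬rep = ⊥-elim (¬rep rep)
        after : nonRep E′ r ≡ true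
        after with rep? E′ r
        ... | yes rep′ = ⊥-elim (¬rep′ rep′)
        ... | no _ rewrite free-unmarked E (proj₁ rep) = refl

      bad-same : (Bad R′ → Bad R) → does (bad? E′) ≡ does (bad? E)
      bad-same h = does-⇔ h bad-mono (bad? E′) (bad? E)

      coarsen-trivial : (∀ {v w} → R′ v w → R v w) → deficit E′ ≡ deficit E × does (bad? E′) ≡ does (bad? E)
      coarsen-trivial R′⊆R =
        deficit-same (λ v (fv , lv) → (λ w r → fv w (R′⊆R r)) , (λ w lt r → lv w lt (R′⊆R r))) ,
        bad-same (λ (α , β , mα , mβ , α≢β , r) → α , β , mα , mβ , α≢β , R′⊆R r)

      Joins : Fin n → Fin n → Set
      Joins a b = ∀ {v w} → R′ v w → R v w ⊎ (R v a × R b w) ⊎ (R v b × R a w)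

      joins-swap : ∀ {a b} → Joins a b → Joins b a
      joins-swap join r with join r
      ... | inj₁ x = inj₁ x
      ... | inj₂ (inj₁ x) = inj₂ (inj₂ x)
      ... | inj₂ (inj₂ x) = inj₂ (inj₁ x)

      -- both classes free: the larger of the two representatives is lost
      module BothFree (a b : Fin n) (join : Joins a b) (a~′b : R′ a b)
                      (fa : Free R a) (fb : Free R b) (lt : minOf E a < minOf E b) where
        ma mb : Fin n
        ma = minOf E a
        mb = minOf E b

        lost : ¬ Rep R′ mb
        lost (_ , lb) = lb ma lt (R′-trans (R⊆R′ (minOf-R E a)) (R′-trans a~′b (R⊆R′ (R-sym (minOf-R E b)))))

        keep : ∀ i → i ≢ mb → Rep R i → Rep R′ i
        keep i i≢mb (fi , li) = free′ , least′
          where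
          free′ : Free R′ i
          free′ w r′ with join r′
          ... | inj₁ r = fi w r
          ... | inj₂ (inj₁ (_ , bw)) = fb w bw
          ... | inj₂ (inj₂ (_ , aw)) = fa w aw
          least′ : Least R′ i
          least′ w w<i r′ with join r′
          ... | inj₁ r = li w w<i r
          ... | inj₂ (inj₁ (_ , bi)) = i≢mb (least-unique E li (minOf-least E b) (R-trans (R-sym bi) (R-sym (minOf-R E b))))
          ... | inj₂ (inj₂ (wb , ai)) with least-unique E li (minOf-least E a) (R-trans (R-sym ai) (R-sym (minOf-R E a)))
          ... | refl = minOf-≤ E b w wb (<-trans w<i lt)

        grows : deficit E′ ≡ suc (deficit E)
        grows = deficit-suc mb (free-trans E fb (R-sym (minOf-R E b)) , minOf-least E b) lost keep

      module Join (a b : Fin n) (join : Joins a b) (a~′b : R′ a b) (a≁b : ¬ R a b) where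

        untouched : ∀ {v w} → ¬ R v a → ¬ R v b → R′ v w → R v w
        untouched ¬va ¬vb r with join r
        ... | inj₁ r = r
        ... | inj₂ (inj₁ (va , _)) = ⊥-elim (¬va va)
        ... | inj₂ (inj₂ (vb , _)) = ⊥-elim (¬vb vb)

        rep-untouched : ∀ {v} → ¬ R v a → ¬ R v b → Rep R v → Rep R′ v
        rep-untouched ¬va ¬vb (fv , lv) =
          (λ w r → fv w (untouched ¬va ¬vb r)) ,
          (λ w lt r → lv w lt (R-sym (untouched ¬va ¬vb (R′-sym r))))

        free-anchored : ∀ {v c} → Free R v → Anchored R c → ¬ R v c
        free-anchored fv (β , mβ , cβ) vc = free⇒¬anchored E fv (β , mβ , R-trans vc cβ)

        joinFree : Free R a → deficit E′ ≡ suc (deficit E) × does (bad? E′) ≡ does (bad? E)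
        joinFree fa = deficit′ , bad-same no-new-bad
          where
          no-new-bad : Bad R′ → Bad R
          no-new-bad (α , β , mα , mβ , α≢β , r′) with join r′
          ... | inj₁ r = α , β , mα , mβ , α≢β , r
          ... | inj₂ (inj₁ (αa , _)) = ⊥-elim (free⇒¬anchored E fa (α , mα , R-sym αa))
          ... | inj₂ (inj₂ (_ , aβ)) = ⊥-elim (free⇒¬anchored E fa (β , mβ , aβ))
          ma : Fin n
          ma = minOf E a
          rep-ma : Rep R ma
          rep-ma = free-trans E fa (R-sym (minOf-R E a)) , minOf-least E a
          deficit′ : deficit E′ ≡ suc (deficit E)
          deficit′ with anchored? E b
          ... | yes (β , mβ , bβ) = deficit-suc ma rep-ma lost keep
            where
            lost : ¬ Rep R′ ma
            lost (fr , _) with trans (sym mβ) (fr β (R′-trans (R⊆R′ (minOf-R E a)) (R′-trans a~′b (R⊆R′ bβ))))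
            ... | ()
            keep : ∀ i → i ≢ ma → Rep R i → Rep R′ i
            keep i i≢ma rep-i = rep-untouched
              (λ ia → i≢ma (least-unique E (proj₂ rep-i) (minOf-least E a) (R-trans ia (R-sym (minOf-R E a)))))
              (free-anchored (proj₁ rep-i) (β , mβ , bβ)) rep-i
          ... | no ¬anch with <-cmp (minOf E a) (minOf E b)
          ... | tri< lt _ _ = BothFree.grows a b join a~′b fa (¬anchored⇒free E ¬anch) lt
          ... | tri> _ _ gt = BothFree.grows b a (joins-swap join) (R′-sym a~′b)
                                (¬anchored⇒free E ¬anch) fa gt
          ... | tri≈ _ eq _ = ⊥-elim (a≁b (R-trans (R-sym (minOf-R E a)) (subst (λ z → R z b) (sym eq) (minOf-R E b))))

        joinAnchored : Anchored R a → Anchored R b → deficit E′ ≡ deficit E × Bad R′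
        joinAnchored (α , mα , aα) (β , mβ , bβ) =
          deficit-same (λ i rep-i → rep-untouched (free-anchored (proj₁ rep-i) (α , mα , aα))
                                                  (free-anchored (proj₁ rep-i) (β , mβ , bβ)) rep-i) ,
          (α , β , mα , mβ , (λ { refl → a≁b (R-trans aα (R-sym bβ)) }) ,
           R′-trans (R⊆R′ (R-sym aα)) (R′-trans a~′b (R⊆R′ bβ)))

module Connectivity {n m : ℕ} (ends : Fin m → Fin n × Fin n) where

  open Subsets
  open import Level using (0ℓ)
  open import Data.Bool using (true; false)
  open import Data.Fin using () renaming (_≟_ to _≟ᶠ_)
  open import Data.Fin.Subset using (Subset)
  open import Data.Vec using (lookup; replicate; _[_]≔_)
  open import Data.Vec.Properties using (lookup∘update; lookup-replicate)
  open import Data.Product using (_×_; _,_; proj₁; proj₂)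
  open import Data.Sum using (_⊎_; inj₁; inj₂)
  open import Function using (id)
  open import Relation.Nullary using (Dec)
  open import Relation.Nullary.Decidable using (_×-dec_; _⊎-dec_; map′)
  open import Relation.Binary using (Rel; IsDecEquivalence)
  open import Relation.Binary.Construct.Closure.ReflexiveTransitive using (Star; ε; _◅_; _◅◅_; gmap; reverse)
  open import Relation.Binary.PropositionalEquality using (_≡_; refl; sym; trans)

  record Step (A : Subset m) (v w : Fin n) : Set where
    constructor step
    field
      edge   : Fin m
      inside : lookup A edge ≡ true
      joins  : SameEnds (ends edge) (v , w)

  Conn : Subset m → Rel (Fin n) 0ℓ
  Conn A = Star (Step A)

  sameEnds-sym : ∀ (p : Fin n × Fin n) {v w} → SameEnds p (v , w) → SameEnds p (w , v)
  sameEnds-sym _ (inj₁ eqs) = inj₂ eqs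
  sameEnds-sym _ (inj₂ eqs) = inj₁ eqs

  conn-sym : ∀ {A v w} → Conn A v w → Conn A w v
  conn-sym = reverse (λ (step e l s) → step e l (sameEnds-sym (ends e) s))

  conn-mono : ∀ {A A′} → (∀ e → lookup A e ≡ true → lookup A′ e ≡ true) → ∀ {v w} → Conn A v w → Conn A′ v w
  conn-mono sub = gmap id (λ (step e l s) → step e (sub e l) s)

  conn-edge : ∀ A e → Conn (A [ e ]≔ true) (proj₁ (ends e)) (proj₂ (ends e))
  conn-edge A e = step e (lookup∘update e A true) (inj₁ (refl , refl)) ◅ ε

  -- the description of connectivity in A ∪ {e} via connectivity in A
  Through : Subset m → Fin n → Fin n → Fin n → Fin n → Set
  Through A a b v w = Conn A v w ⊎ (Conn A v a × Conn A b w) ⊎ (Conn A v b × Conn A a w)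

  private
    through-step : ∀ {A a b u u′ w} → Step A u u′ → Through A a b u′ w → Through A a b u w
    through-step s (inj₁ c)                 = inj₁ (s ◅ c)
    through-step s (inj₂ (inj₁ (c₁ , c₂))) = inj₂ (inj₁ (s ◅ c₁ , c₂))
    through-step s (inj₂ (inj₂ (c₁ , c₂))) = inj₂ (inj₂ (s ◅ c₁ , c₂))

    through-ab : ∀ {A a b w} → Through A a b b w → Through A a b a w
    through-ab (inj₁ c)                 = inj₂ (inj₁ (ε , c))
    through-ab (inj₂ (inj₁ (c₁ , c₂))) = inj₁ (conn-sym c₁ ◅◅ c₂)
    through-ab (inj₂ (inj₂ (_ , c₂)))  = inj₁ c₂

    through-ba : ∀ {A a b w} → Through A a b a w → Through A a b b w
    through-ba (inj₁ c)                 = inj₂ (inj₂ (ε , c))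
    through-ba (inj₂ (inj₁ (_ , c₂)))  = inj₁ c₂
    through-ba (inj₂ (inj₂ (c₁ , c₂))) = inj₁ (conn-sym c₁ ◅◅ c₂)

    through-edge : ∀ {A u u′ w} e → SameEnds (ends e) (u , u′) →
                   Through A (proj₁ (ends e)) (proj₂ (ends e)) u′ w → Through A (proj₁ (ends e)) (proj₂ (ends e)) u w
    through-edge e (inj₁ (refl , refl)) = through-ab
    through-edge e (inj₂ (refl , refl)) = through-ba

  conn-insert : ∀ A e {v w} → Conn (A [ e ]≔ true) v w → Through A (proj₁ (ends e)) (proj₂ (ends e)) v w
  conn-insert A e ε = inj₁ ε
  conn-insert A e (step e′ l s ◅ p) with ∈-insert⁻ A e e′ l
  ... | inj₁ refl = through-edge e s (conn-insert A e p)
  ... | inj₂ l′   = through-step (step e′ l′ s) (conn-insert A e p)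

  conn-insert⁻ : ∀ A e {v w} → Through A (proj₁ (ends e)) (proj₂ (ends e)) v w → Conn (A [ e ]≔ true) v w
  conn-insert⁻ A e (inj₁ c) = conn-mono (∈-insert⁺ A e) c
  conn-insert⁻ A e (inj₂ (inj₁ (c₁ , c₂))) =
    conn-mono (∈-insert⁺ A e) c₁ ◅◅ conn-edge A e ◅◅ conn-mono (∈-insert⁺ A e) c₂
  conn-insert⁻ A e (inj₂ (inj₂ (c₁ , c₂))) =
    conn-mono (∈-insert⁺ A e) c₁ ◅◅ conn-sym (conn-edge A e) ◅◅ conn-mono (∈-insert⁺ A e) c₂

  conn-empty : ∀ {v w} → Conn (replicate m false) v w → v ≡ w
  conn-empty ε = refl
  conn-empty (step e l _ ◅ _) with trans (sym (lookup-replicate e false)) l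
  ... | ()

  conn? : ∀ A v w → Dec (Conn A v w)
  conn? = insertion-induction (λ A → ∀ v w → Dec (Conn A v w)) empty insert
    where
    empty : ∀ v w → Dec (Conn (replicate m false) v w)
    empty v w = map′ (λ { refl → ε }) conn-empty (v ≟ᶠ w)
    insert : ∀ A e → lookup A e ≡ false → (∀ v w → Dec (Conn A v w)) →
             ∀ v w → Dec (Conn (A [ e ]≔ true) v w)
    insert A e _ d v w = map′ (conn-insert⁻ A e) (conn-insert A e)
      (d v w ⊎-dec ((d v a ×-dec d b w) ⊎-dec (d v b ×-dec d a w)))
      where a = proj₁ (ends e)
            b = proj₂ (ends e)

  components : ∀ A → IsDecEquivalence (Conn A)
  components A = record
    { isEquivalence = record { refl = ε ; sym = conn-sym ; trans = _◅◅_ }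
    ; _≟_ = conn? A }

-- Linear algebra for the vectors of M(N) over F: finite sums, pairing with
-- a linear functional φ, spans, and the two ways independence is decided:
-- a vector in the span of S makes S + x dependent, while a functional that
-- vanishes on S but not on v_x keeps an independent S + x independent.
module Linear {c ℓ} (N : Network) (F : Field c ℓ) (u : Fin (Network.n N) → Field.Carrier F) where

  open Subsets using (∈-insert⁻)
  open Network N
  open Field F hiding (zero)
  open DirichletMatroid N F u
  open import Data.Nat using (zero; suc)
  open import Data.Bool using (true; false; if_then_else_)
  open import Data.Fin using (zero; suc; _≟_)
  open import Data.Fin.Properties using (suc-injective)
  open import Data.Fin.Subset using (Subset)
  open import Data.Vec using (lookup; replicate; _[_]≔_)
  open import Data.Vec.Properties using (lookup∘update; lookup∘update′; lookup-replicate)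
  open import Data.Maybe using (just; nothing)
  open import Data.Product using (_,_; proj₁; proj₂)
  open import Data.Sum using (inj₁; inj₂)
  open import Data.Empty using (⊥-elim)
  open import Function using (_∘_)
  open import Relation.Nullary using (¬_; yes; no; does)
  open import Relation.Binary.PropositionalEquality as P using (_≡_; _≢_)
  open import Relation.Binary.Reasoning.Setoid setoid
  open import Algebra.Properties.Ring ring using (-1*x≈-x)
  open import Algebra.Properties.AbelianGroup +-abelianGroup using (x∙y⁻¹≈ε⇒x≈y; x≈y⇒x∙y⁻¹≈ε; ⁻¹-anti-homo‿-; ⁻¹-involutive; ε⁻¹≈ε)
  open import Algebra.Properties.CommutativeSemigroup +-commutativeSemigroup using (interchange)
  open import Algebra.Properties.CommutativeSemigroup *-commutativeSemigroup using (x∙yz≈y∙xz)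

  cancel : ∀ {a b} → a * b ≈ 0# → ¬ (b ≈ 0#) → a ≈ 0#
  cancel {a} {b} ab≈0 b≉0 with inverse b b≉0
  ... | b⁻¹ , bb⁻¹≈1 = begin
    a              ≈⟨ sym (*-identityʳ a) ⟩
    a * 1#         ≈⟨ *-congˡ (sym bb⁻¹≈1) ⟩
    a * (b * b⁻¹)  ≈⟨ sym (*-assoc a b b⁻¹) ⟩
    (a * b) * b⁻¹  ≈⟨ *-congʳ ab≈0 ⟩
    0# * b⁻¹       ≈⟨ zeroˡ b⁻¹ ⟩
    0#             ∎

  1≉0 : ¬ (1# ≈ 0#)
  1≉0 z = 0≉1 (sym z)

  -1≉0 : ¬ (- 1# ≈ 0#)
  -1≉0 z = 1≉0 (trans (sym (⁻¹-involutive 1#)) (trans (-‿cong z) ε⁻¹≈ε))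

  diff-trans : ∀ x y z → (x - y) + (y - z) ≈ x - z
  diff-trans x y z = begin
    (x - y) + (y - z)    ≈⟨ +-assoc x (- y) (y - z) ⟩
    x + (- y + (y - z))  ≈⟨ +-congˡ (sym (+-assoc (- y) y (- z))) ⟩
    x + ((- y + y) - z)  ≈⟨ +-congˡ (+-congʳ (-‿inverseˡ y)) ⟩
    x + (0# - z)         ≈⟨ +-congˡ (+-identityˡ (- z)) ⟩
    x - z                ∎

  sum-cong : ∀ {k} {f g : Fin k → Carrier} → (∀ i → f i ≈ g i) → sumFin f ≈ sumFin g
  sum-cong {zero}  h = refl
  sum-cong {suc k} h = +-cong (h zero) (sum-cong (h ∘ suc))

  sum-0 : ∀ {k} {f : Fin k → Carrier} → (∀ i → f i ≈ 0#) → sumFin f ≈ 0#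
  sum-0 {zero}  h = refl
  sum-0 {suc k} h = trans (+-cong (h zero) (sum-0 (h ∘ suc))) (+-identityʳ 0#)

  sum-+ : ∀ {k} (f g : Fin k → Carrier) → sumFin (λ i → f i + g i) ≈ sumFin f + sumFin g
  sum-+ {zero}  f g = sym (+-identityʳ 0#)
  sum-+ {suc k} f g = trans (+-congˡ (sum-+ (f ∘ suc) (g ∘ suc))) (interchange (f zero) (g zero) _ _)

  sum-* : ∀ {k} (a : Carrier) (f : Fin k → Carrier) → sumFin (λ i → a * f i) ≈ a * sumFin f
  sum-* {zero}  a f = sym (zeroʳ a)
  sum-* {suc k} a f = trans (+-congˡ (sum-* a (f ∘ suc))) (sym (distribˡ a (f zero) _))

  sum-single : ∀ {k} (f : Fin k → Carrier) (j : Fin k) → (∀ i → i ≢ j → f i ≈ 0#) → sumFin f ≈ f j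
  sum-single {suc k} f zero h = trans (+-congˡ (sum-0 (λ i → h (suc i) (λ ())))) (+-identityʳ (f zero))
  sum-single {suc k} f (suc j) h =
    trans (+-cong (h zero (λ ())) (sum-single (f ∘ suc) j (λ i ne → h (suc i) (ne ∘ suc-injective))))
          (+-identityˡ _)

  restrict : ∀ {k} → Subset k → (Fin k → Carrier) → Fin k → Carrier
  restrict T h g = if lookup T g then h g else 0#

  sum-insert : ∀ {k} (T : Subset k) x (h : Fin k → Carrier) → lookup T x ≡ false →
               sumFin (restrict (T [ x ]≔ true) h) ≈ h x + sumFin (restrict T h)
  sum-insert {k} T x h x∉T = begin
    sumFin (restrict (T [ x ]≔ true) h)                 ≈⟨ sum-cong split ⟩
    sumFin (λ g → at-x g + restrict T h g)              ≈⟨ sum-+ at-x (restrict T h) ⟩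
    sumFin at-x + sumFin (restrict T h)                 ≈⟨ +-congʳ (sum-single at-x x off-x) ⟩
    at-x x + sumFin (restrict T h)                      ≈⟨ +-congʳ on-x ⟩
    h x + sumFin (restrict T h)                         ∎
    where
    at-x : Fin k → Carrier
    at-x g = if does (g ≟ x) then h g else 0#
    on-x : at-x x ≈ h x
    on-x with x ≟ x
    ... | yes _ = refl
    ... | no ne = ⊥-elim (ne P.refl)
    off-x : ∀ i → i ≢ x → at-x i ≈ 0#
    off-x i ne with i ≟ x
    ... | yes e = ⊥-elim (ne e)
    ... | no _  = refl
    split : ∀ g → restrict (T [ x ]≔ true) h g ≈ at-x g + restrict T h g
    split g with g ≟ x
    ... | yes P.refl rewrite lookup∘update g T true | x∉T = sym (+-identityʳ (h g))
    ... | no ne rewrite lookup∘update′ ne T true = sym (+-identityˡ _)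

  Vect : Set c
  Vect = Coord → Carrier

  pair : Vect → Vect → Carrier
  pair φ v = φ nothing * v nothing + sumFin (λ i → φ (just i) * v (just i))

  pair-cong : ∀ φ {v w : Vect} → (∀ x → v x ≈ w x) → pair φ v ≈ pair φ w
  pair-cong φ h = +-cong (*-congˡ (h nothing)) (sum-cong {n} (λ i → *-congˡ (h (just i))))

  pair-0 : ∀ φ → pair φ (λ _ → 0#) ≈ 0#
  pair-0 φ = trans (+-cong (zeroʳ _) (sum-0 {n} (λ i → zeroʳ _))) (+-identityʳ 0#)

  pair-+ : ∀ φ (v w : Vect) → pair φ (λ x → v x + w x) ≈ pair φ v + pair φ w
  pair-+ φ v w = trans
    (+-cong (distribˡ _ _ _) (trans (sum-cong {n} (λ i → distribˡ _ _ _)) (sum-+ {n} _ _)))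
    (interchange _ _ _ _)

  pair-* : ∀ φ (a : Carrier) (v : Vect) → pair φ (λ x → a * v x) ≈ a * pair φ v
  pair-* φ a v = trans
    (+-cong (x∙yz≈y∙xz _ _ _) (trans (sum-cong {n} (λ i → x∙yz≈y∙xz _ _ _)) (sum-* {n} a _)))
    (sym (distribˡ a _ _))

  pair-sum : ∀ {k} φ (G : Fin k → Vect) → pair φ (λ x → sumFin (λ g → G g x)) ≈ sumFin (λ g → pair φ (G g))
  pair-sum {zero}  φ G = pair-0 φ
  pair-sum {suc k} φ G = trans (pair-+ φ (G zero) (λ x → sumFin (λ g → G (suc g) x))) (+-congˡ (pair-sum φ (G ∘ suc)))

  pair-δ : ∀ φ c → pair φ (δ c) ≈ φ c
  pair-δ φ nothing = trans (+-cong (*-identityʳ _) (sum-0 {n} (λ i → zeroʳ _))) (+-identityʳ _)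
  pair-δ φ (just j) = trans (+-cong (zeroʳ _) (sum-single {n} _ j off-j)) (trans (+-identityˡ _) on-j)
    where
    off-j : ∀ i → i ≢ j → φ (just i) * δ (just j) (just i) ≈ 0#
    off-j i ne with j ≟ i
    ... | yes e = ⊥-elim (ne (P.sym e))
    ... | no _  = zeroʳ _
    on-j : φ (just j) * δ (just j) (just j) ≈ φ (just j)
    on-j with j ≟ j
    ... | yes _ = *-identityʳ _
    ... | no ne = ⊥-elim (ne P.refl)

  comb : Subset (suc m) → (Fin (suc m) → Carrier) → Vect
  comb S coef x = sumFin (restrict S (λ g → coef g * vec g x))

  pair-comb : ∀ φ S coef → pair φ (comb S coef) ≈ sumFin (restrict S (λ g → coef g * pair φ (vec g)))
  pair-comb φ S coef = trans (pair-sum φ (λ g y → restrict S (λ g → coef g * vec g y) g)) (sum-cong λ g → on {g} (lookup S g))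
    where
    on : ∀ {g} b → pair φ (λ y → if b then coef g * vec g y else 0#) ≈ (if b then coef g * pair φ (vec g) else 0#)
    on {g} true  = pair-* φ (coef g) (vec g)
    on     false = pair-0 φ

  Annihilates : Vect → Subset (suc m) → Set ℓ
  Annihilates φ T = ∀ g → lookup T g ≡ true → pair φ (vec g) ≈ 0#

  annihilated-sum : ∀ φ T → Annihilates φ T → ∀ (h : Fin (suc m) → Carrier) →
                    sumFin (restrict T (λ g → h g * pair φ (vec g))) ≈ 0#
  annihilated-sum φ T ann h = sum-0 term
    where
    term : ∀ g → restrict T (λ g → h g * pair φ (vec g)) g ≈ 0#
    term g with lookup T g in g∈T
    ... | true  = trans (*-congˡ (ann g g∈T)) (zeroʳ _)
    ... | false = refl

  indep-empty : Independent (replicate (suc m) false)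
  indep-empty coef h g l with P.trans (P.sym (lookup-replicate g false)) l
  ... | ()

  indep-sub : ∀ T T′ → (∀ g → lookup T g ≡ true → lookup T′ g ≡ true) → Independent T′ → Independent T
  indep-sub T T′ sub ind coef vanish g g∈T = trans (sym (agrees g g∈T)) (ind coef′ vanish′ g (sub g g∈T))
    where
    coef′ : Fin (suc m) → Carrier
    coef′ g = if lookup T g then coef g else 0#
    agrees : ∀ g → lookup T g ≡ true → coef′ g ≈ coef g
    agrees g l rewrite l = refl
    same-term : ∀ x g → restrict T′ (λ g → coef′ g * vec g x) g ≈ restrict T (λ g → coef g * vec g x) g
    same-term x g with lookup T g in lt | lookup T′ g in lt′
    ... | true  | true  = refl
    ... | true  | false with P.trans (P.sym (sub g lt)) lt′
    ... | ()
    same-term x g | false | true  = zeroˡ _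
    same-term x g | false | false = refl
    vanish′ : ∀ x → comb T′ coef′ x ≈ 0#
    vanish′ x = trans (sum-cong (same-term x)) (vanish x)

  separated-coef : ∀ T x φ coef → lookup T x ≡ false → Annihilates φ T → ¬ (pair φ (vec x) ≈ 0#) →
                   (∀ y → comb (T [ x ]≔ true) coef y ≈ 0#) → coef x ≈ 0#
  separated-coef T x φ coef x∉T ann nz vanish = cancel (begin
    coef x * pair φ (vec x)                                               ≈⟨ sym (+-identityʳ _) ⟩
    coef x * pair φ (vec x) + 0#                                          ≈⟨ +-congˡ (sym (annihilated-sum φ T ann coef)) ⟩
    coef x * pair φ (vec x) + sumFin (restrict T (λ g → coef g * pair φ (vec g)))
      ≈⟨ sym (sum-insert T x (λ g → coef g * pair φ (vec g)) x∉T) ⟩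
    sumFin (restrict (T [ x ]≔ true) (λ g → coef g * pair φ (vec g)))     ≈⟨ sym (pair-comb φ (T [ x ]≔ true) coef) ⟩
    pair φ (comb (T [ x ]≔ true) coef)                                    ≈⟨ pair-cong φ vanish ⟩
    pair φ (λ _ → 0#)                                                     ≈⟨ pair-0 φ ⟩
    0#                                                                    ∎) nz

  indep-insert : ∀ T x φ → Independent T → lookup T x ≡ false → Annihilates φ T → ¬ (pair φ (vec x) ≈ 0#) →
                 Independent (T [ x ]≔ true)
  indep-insert T x φ ind x∉T ann nz coef vanish g g∈ with ∈-insert⁻ T x g g∈
  ... | inj₁ P.refl = separated-coef T x φ coef x∉T ann nz vanish
  ... | inj₂ g∈T = ind coef vanish-T g g∈T
    where
    cx≈0 : coef x ≈ 0#
    cx≈0 = separated-coef T x φ coef x∉T ann nz vanish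
    vanish-T : ∀ y → comb T coef y ≈ 0#
    vanish-T y = begin
      comb T coef y                       ≈⟨ sym (+-identityˡ _) ⟩
      0# + comb T coef y                  ≈⟨ +-congʳ (sym (trans (*-congʳ cx≈0) (zeroˡ _))) ⟩
      coef x * vec x y + comb T coef y    ≈⟨ sym (sum-insert T x (λ g → coef g * vec g y) x∉T) ⟩
      comb (T [ x ]≔ true) coef y         ≈⟨ vanish y ⟩
      0#                                  ∎

  record InSpan (S : Subset (suc m)) (v : Vect) : Set (c ⊔ ℓ) where
    constructor span
    field
      coef  : Fin (suc m) → Carrier
      equal : ∀ x → v x ≈ comb S coef x

  span⇒dependent : ∀ T x → lookup T x ≡ false → InSpan T (vec x) → ¬ Independent (T [ x ]≔ true)
  span⇒dependent T x x∉T (span cf eq) ind = -1≉0 (trans (sym cx) (ind coef vanish x (lookup∘update x T true)))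
    where
    coef : Fin (suc m) → Carrier
    coef g = if does (g ≟ x) then - 1# else cf g
    cx : coef x ≈ - 1#
    cx with x ≟ x
    ... | yes _ = refl
    ... | no ne = ⊥-elim (ne P.refl)
    same-term : ∀ y g → restrict T (λ g → coef g * vec g y) g ≈ restrict T (λ g → cf g * vec g y) g
    same-term y g with lookup T g in g∈T
    ... | false = refl
    ... | true with g ≟ x
    ... | yes P.refl with P.trans (P.sym g∈T) x∉T
    ... | ()
    same-term y g | true | no _ = refl
    vanish : ∀ y → comb (T [ x ]≔ true) coef y ≈ 0#
    vanish y = begin
      comb (T [ x ]≔ true) coef y       ≈⟨ sum-insert T x (λ g → coef g * vec g y) x∉T ⟩
      coef x * vec x y + comb T coef y  ≈⟨ +-cong (trans (*-congʳ cx) (-1*x≈-x _)) (trans (sum-cong (same-term y)) (sym (eq y))) ⟩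
      - vec x y + vec x y               ≈⟨ -‿inverseˡ _ ⟩
      0#                                ∎

  span-gen : ∀ S g → lookup S g ≡ true → InSpan S (vec g)
  span-gen S g g∈S = span cf (λ x → sym (trans (sum-single _ g (off-g x)) (on-g x)))
    where
    cf : Fin (suc m) → Carrier
    cf g′ = if does (g′ ≟ g) then 1# else 0#
    off-g : ∀ x i → i ≢ g → restrict S (λ g → cf g * vec g x) i ≈ 0#
    off-g x i ne with lookup S i
    ... | false = refl
    ... | true with i ≟ g
    ... | yes e = ⊥-elim (ne e)
    ... | no _  = zeroˡ _
    on-g : ∀ x → restrict S (λ g → cf g * vec g x) g ≈ vec g x
    on-g x rewrite g∈S with g ≟ g
    ... | yes _ = *-identityˡ _
    ... | no ne = ⊥-elim (ne P.refl)

  span-cong : ∀ {S v w} → (∀ x → v x ≈ w x) → InSpan S v → InSpan S w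
  span-cong h (span cf eq) = span cf (λ x → trans (sym (h x)) (eq x))

  span-0 : ∀ {S} → InSpan S (λ _ → 0#)
  span-0 {S} = span (λ _ → 0#) (λ x → sym (sum-0 (term x)))
    where
    term : ∀ x g → restrict S (λ g → 0# * vec g x) g ≈ 0#
    term x g with lookup S g
    ... | true  = zeroˡ _
    ... | false = refl

  span-+ : ∀ {S v w} → InSpan S v → InSpan S w → InSpan S (λ x → v x + w x)
  span-+ {S} (span c₁ eq₁) (span c₂ eq₂) = span (λ g → c₁ g + c₂ g) λ x →
    trans (+-cong (eq₁ x) (eq₂ x)) (sym (trans (sum-cong (term x)) (sum-+ (restrict S (λ g → c₁ g * vec g x)) (restrict S (λ g → c₂ g * vec g x)))))
    where
    term : ∀ x g → restrict S (λ g → (c₁ g + c₂ g) * vec g x) g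
                 ≈ restrict S (λ g → c₁ g * vec g x) g + restrict S (λ g → c₂ g * vec g x) g
    term x g with lookup S g
    ... | true  = distribʳ _ _ _
    ... | false = sym (+-identityʳ 0#)

  span-* : ∀ {S v} (a : Carrier) → InSpan S v → InSpan S (λ x → a * v x)
  span-* {S} a (span c eq) = span (λ g → a * c g) λ x →
    trans (*-congˡ (eq x)) (sym (trans (sum-cong (term x)) (sum-* a (restrict S (λ g → c g * vec g x)))))
    where
    term : ∀ x g → restrict S (λ g → (a * c g) * vec g x) g ≈ a * restrict S (λ g → c g * vec g x) g
    term x g with lookup S g
    ... | true  = *-assoc _ _ _
    ... | false = sym (zeroʳ a)

  span-neg : ∀ {S v} → InSpan S v → InSpan S (λ x → - v x)
  span-neg h = span-cong (λ x → -1*x≈-x _) (span-* (- 1#) h)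

  -- Vertex vectors: π v = e_v for interior v and u(v)·e_0 for boundary v, so
  -- that the vector of an edge vw is ±(π v − π w).  The value of φ at π v is
  -- its potential at v.

  π : Fin n → Vect
  π v x = if isB v then u v * δ nothing x else δ (just v) x

  potential : Vect → Fin n → Carrier
  potential φ v = if isB v then u v * φ nothing else φ (just v)

  pair-π : ∀ φ v → pair φ (π v) ≈ potential φ v
  pair-π φ v with isB v
  ... | true  = trans (pair-* φ (u v) (δ nothing)) (*-congˡ (pair-δ φ nothing))
  ... | false = pair-δ φ (just v)

  vec-edge : ∀ e x → vec (suc e) x ≈
    (if isB (proj₁ (ends e)) then π (proj₂ (ends e)) x - π (proj₁ (ends e)) x
                             else π (proj₁ (ends e)) x - π (proj₂ (ends e)) x)
  vec-edge e x with boundaryIndep e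
  ... | indep with isB (proj₁ (ends e))
  ... | false = refl
  ... | true with isB (proj₂ (ends e))
  ... | false = refl
  ... | true = ⊥-elim (indep (P.refl , P.refl))

  pair-edge : ∀ φ e → pair φ (vec (suc e)) ≈
    (if isB (proj₁ (ends e)) then potential φ (proj₂ (ends e)) - potential φ (proj₁ (ends e))
                             else potential φ (proj₁ (ends e)) - potential φ (proj₂ (ends e)))
  pair-edge φ e = trans (pair-cong φ (vec-edge e)) (oriented (isB (proj₁ (ends e))))
    where
    diff : ∀ v w → pair φ (λ x → π v x - π w x) ≈ potential φ v - potential φ w
    diff v w = begin
      pair φ (λ x → π v x - π w x)              ≈⟨ pair-+ φ (π v) (λ x → - π w x) ⟩
      pair φ (π v) + pair φ (λ x → - π w x)     ≈⟨ +-congˡ (pair-cong φ (λ x → sym (-1*x≈-x (π w x)))) ⟩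
      pair φ (π v) + pair φ (λ x → - 1# * π w x) ≈⟨ +-congˡ (pair-* φ (- 1#) (π w)) ⟩
      pair φ (π v) + - 1# * pair φ (π w)        ≈⟨ +-cong (pair-π φ v) (trans (-1*x≈-x _) (-‿cong (pair-π φ w))) ⟩
      potential φ v - potential φ w             ∎
    oriented : ∀ t → pair φ (λ x → if t then π (proj₂ (ends e)) x - π (proj₁ (ends e)) x
                                        else π (proj₁ (ends e)) x - π (proj₂ (ends e)) x)
                   ≈ (if t then potential φ (proj₂ (ends e)) - potential φ (proj₁ (ends e))
                           else potential φ (proj₁ (ends e)) - potential φ (proj₂ (ends e)))
    oriented true  = diff _ _
    oriented false = diff _ _

  edge-vanishes : ∀ φ e → potential φ (proj₁ (ends e)) ≈ potential φ (proj₂ (ends e)) →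
                  pair φ (vec (suc e)) ≈ 0#
  edge-vanishes φ e eq = trans (pair-edge φ e) (oriented (isB (proj₁ (ends e))))
    where
    oriented : ∀ t → (if t then potential φ (proj₂ (ends e)) - potential φ (proj₁ (ends e))
                           else potential φ (proj₁ (ends e)) - potential φ (proj₂ (ends e))) ≈ 0#
    oriented true  = x≈y⇒x∙y⁻¹≈ε (sym eq)
    oriented false = x≈y⇒x∙y⁻¹≈ε eq

  edge-nonvanishing : ∀ φ e → ¬ (potential φ (proj₁ (ends e)) ≈ potential φ (proj₂ (ends e))) →
                      ¬ (pair φ (vec (suc e)) ≈ 0#)
  edge-nonvanishing φ e ne z = oriented (isB (proj₁ (ends e))) (trans (sym (pair-edge φ e)) z)
    where
    oriented : ∀ t → ¬ ((if t then potential φ (proj₂ (ends e)) - potential φ (proj₁ (ends e))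
                              else potential φ (proj₁ (ends e)) - potential φ (proj₂ (ends e))) ≈ 0#)
    oriented true  z = ne (sym (x∙y⁻¹≈ε⇒x≈y _ _ z))
    oriented false z = ne (x∙y⁻¹≈ε⇒x≈y _ _ z)

  span-flip : ∀ {S} v w → InSpan S (λ x → π v x - π w x) → InSpan S (λ x → π w x - π v x)
  span-flip v w h = span-cong (λ x → ⁻¹-anti-homo‿- (π v x) (π w x)) (span-neg h)

  span-edge⁺ : ∀ S e → InSpan S (λ x → π (proj₁ (ends e)) x - π (proj₂ (ends e)) x) → InSpan S (vec (suc e))
  span-edge⁺ S e h = span-cong (λ x → sym (vec-edge e x)) (oriented (isB (proj₁ (ends e))))
    where
    oriented : ∀ t → InSpan S (λ x → if t then π (proj₂ (ends e)) x - π (proj₁ (ends e)) x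
                                          else π (proj₁ (ends e)) x - π (proj₂ (ends e)) x)
    oriented true  = span-flip _ _ h
    oriented false = h

  span-edge⁻ : ∀ S e → InSpan S (vec (suc e)) → InSpan S (λ x → π (proj₁ (ends e)) x - π (proj₂ (ends e)) x)
  span-edge⁻ S e h = oriented (isB (proj₁ (ends e))) (span-cong (vec-edge e) h)
    where
    oriented : ∀ t → InSpan S (λ x → if t then π (proj₂ (ends e)) x - π (proj₁ (ends e)) x
                                          else π (proj₁ (ends e)) x - π (proj₂ (ends e)) x) →
                     InSpan S (λ x → π (proj₁ (ends e)) x - π (proj₂ (ends e)) x)
    oriented true  = span-flip _ _
    oriented false h = h

-- For a set S = (b, A) of elements (b says
-- whether e₀ ∈ S, A ⊆ E), the rank is
--      rankOf S = (#interior − #free components of A) + [e₀ ∈ S or A is bad],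
-- where a component is free if it has no boundary node and A is bad if it
-- joins two distinct boundary nodes.
module RankFormula {c ℓ} (N : Network) (F : Field c ℓ) (u : Fin (Network.n N) → Field.Carrier F)
    (u-injective : ∀ i j → Network.isB N i ≡ true → Network.isB N j ≡ true → Field._≈_ F (u i) (u j) → i ≡ j) where

  open Subsets
  open Network N
  open Field F hiding (zero)
  open DirichletMatroid N F u
  open Linear N F u
  open Connectivity ends
  open Components.Marked isB
  open import Data.Nat using (zero; suc; _≤_; z≤n; s≤s) renaming (_+_ to _+ℕ_)
  open import Data.Nat.Properties using (+-suc; +-mono-≤; ≤-antisym; ≤-trans)
  open import Data.Bool using (Bool; true; false; if_then_else_; _∨_)
  open import Data.Bool.Properties using (∨-zeroʳ)
  open import Data.Fin using (zero; suc)
  open import Data.Fin.Properties using (<-irrefl)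
  open import Data.Fin.Subset using (Subset; ∣_∣; _⊆_)
  open import Data.Fin.Subset.Properties using (∣⊥∣≡0)
  open import Data.Vec using (_∷_; lookup; replicate; _[_]≔_)
  open import Data.Vec.Properties using (lookup∘update; []=⇒lookup; lookup⇒[]=)
  open import Data.Maybe using (just; nothing)
  open import Data.Product using (Σ; _,_; proj₁; proj₂)
  open import Data.Sum using (inj₁; inj₂)
  open import Data.Empty using (⊥-elim)
  open import Function using (_∘_)
  open import Relation.Nullary using (¬_; Dec; yes; no; does)
  open import Relation.Binary.Construct.Closure.ReflexiveTransitive using (ε; _◅_; _◅◅_)
  open import Relation.Binary.PropositionalEquality as P using (_≡_; _≢_)
  open import Relation.Binary.Reasoning.Setoid setoid
  open import Algebra.Properties.Ring ring using ([y-z]x≈yx-zx)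
  open import Algebra.Properties.AbelianGroup +-abelianGroup using (x∙y⁻¹≈ε⇒x≈y; x≈y⇒x∙y⁻¹≈ε)

  rankOf : Subset (suc m) → ℕ
  rankOf (b ∷ A) = deficit (components A) +ℕ ind (b ∨ does (bad? (components A)))

  conn-span : ∀ b A {v w} → Conn A v w → InSpan (b ∷ A) (λ x → π v x - π w x)
  conn-span b A {v} ε = span-cong (λ x → sym (-‿inverseʳ (π v x))) span-0
  conn-span b A {v} {w} (step e l s ◅ p) =
    span-cong (λ x → diff-trans (π v x) _ (π w x)) (span-+ (edge-span s) (conn-span b A p))
    where
    edge-span : ∀ {v v′} → SameEnds (ends e) (v , v′) → InSpan (b ∷ A) (λ x → π v x - π v′ x)
    edge-span (inj₁ (P.refl , P.refl)) = span-edge⁻ (b ∷ A) e (span-gen (b ∷ A) (suc e) l)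
    edge-span (inj₂ (P.refl , P.refl)) = span-flip _ _ (span-edge⁻ (b ∷ A) e (span-gen (b ∷ A) (suc e) l))

  boundary-span : ∀ {S α β} → InSpan S (δ nothing) → isB α ≡ true → isB β ≡ true → InSpan S (λ x → π α x - π β x)
  boundary-span {S} {α} {β} h mα mβ = span-cong eq (span-* (u α - u β) h)
    where
    eq : ∀ x → (u α - u β) * δ nothing x ≈ π α x - π β x
    eq x rewrite mα | mβ = [y-z]x≈yx-zx (δ nothing x) (u α) (u β)

  u-separates : ∀ {α β} → isB α ≡ true → isB β ≡ true → α ≢ β → ¬ (u α - u β ≈ 0#)
  u-separates mα mβ α≢β z = α≢β (u-injective _ _ mα mβ (x∙y⁻¹≈ε⇒x≈y _ _ z))

  -- a bad A spans e₀: a path between boundary nodes α ≠ β gives (u α − u β) e₀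
  bad-spans-e₀ : ∀ b A → Bad (Conn A) → InSpan (b ∷ A) (δ nothing)
  bad-spans-e₀ b A (α , β , mα , mβ , α≢β , r) with inverse (u α - u β) (u-separates mα mβ α≢β)
  ... | y , dy = span-cong eq (span-* y (conn-span b A r))
    where
    eq : ∀ x → y * (π α x - π β x) ≈ δ nothing x
    eq x rewrite mα | mβ = begin
      y * (u α * δ nothing x - u β * δ nothing x)  ≈⟨ *-congˡ (sym ([y-z]x≈yx-zx (δ nothing x) (u α) (u β))) ⟩
      y * ((u α - u β) * δ nothing x)              ≈⟨ sym (*-assoc _ _ _) ⟩
      (y * (u α - u β)) * δ nothing x              ≈⟨ *-congʳ (trans (*-comm _ _) dy) ⟩
      1# * δ nothing x                             ≈⟨ *-identityˡ _ ⟩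
      δ nothing x                                  ∎

  -- Functionals vanishing on S: those whose potential is constant on the
  -- components of A, namely indicators of free components and, when A is not
  -- bad, the extension of u from the boundary (which is nonzero on e₀).

  constant⇒annihilates : ∀ φ A → (∀ p q → Conn A p q → potential φ p ≈ potential φ q) →
                         ∀ e → lookup A e ≡ true → pair φ (vec (suc e)) ≈ 0#
  constant⇒annihilates φ A const e l = edge-vanishes φ e (const _ _ (step e l (inj₁ (P.refl , P.refl)) ◅ ε))

  indicator : Subset m → Fin n → Vect
  indicator A c nothing  = 0#
  indicator A c (just v) = if does (conn? A c v) then 1# else 0#

  potential-indicator : ∀ A c → Free (Conn A) c → ∀ v →
                        potential (indicator A c) v ≈ (if does (conn? A c v) then 1# else 0#)
  potential-indicator A c fc v with isB v in mv
  ... | false = refl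
  ... | true with conn? A c v
  ... | yes r with P.trans (P.sym mv) (fc v r)
  ... | ()
  potential-indicator A c fc v | true | no _ = zeroʳ _

  indicator-annihilates : ∀ b A c → Free (Conn A) c → Annihilates (indicator A c) (b ∷ A)
  indicator-annihilates b A c fc zero    _ = pair-δ (indicator A c) nothing
  indicator-annihilates b A c fc (suc e) l = constant⇒annihilates (indicator A c) A const e l
    where
    const : ∀ p q → Conn A p q → potential (indicator A c) p ≈ potential (indicator A c) q
    const p q r = trans (potential-indicator A c fc p) (trans (reflexive (P.cong (λ t → if t then 1# else 0#)
      (does-⇔ (_◅◅ r) (_◅◅ conn-sym r) (conn? A c p) (conn? A c q)))) (sym (potential-indicator A c fc q)))

  indicator-separates : ∀ A c w → Free (Conn A) c → ¬ Conn A c w →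
                        ¬ (potential (indicator A c) c ≈ potential (indicator A c) w)
  indicator-separates A c w fc ¬cw eq = 1≉0 (trans (sym one) (trans eq zero′))
    where
    one : potential (indicator A c) c ≈ 1#
    one = trans (potential-indicator A c fc c) on
      where
      on : (if does (conn? A c c) then 1# else 0#) ≈ 1#
      on with conn? A c c
      ... | yes _ = refl
      ... | no ¬r = ⊥-elim (¬r ε)
    zero′ : potential (indicator A c) w ≈ 0#
    zero′ = trans (potential-indicator A c fc w) off
      where
      off : (if does (conn? A c w) then 1# else 0#) ≈ 0#
      off with conn? A c w
      ... | yes r = ⊥-elim (¬cw r)
      ... | no _ = refl

  boundaryValue : Subset m → Fin n → Carrier
  boundaryValue A v with anchored? (components A) v
  ... | yes (β , _ , _) = u β
  ... | no _ = 0#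

  extension : Subset m → Vect
  extension A nothing  = 1#
  extension A (just v) = boundaryValue A v

  boundaryValue-eq : ∀ A v β → ¬ Bad (Conn A) → isB β ≡ true → Conn A v β → boundaryValue A v ≈ u β
  boundaryValue-eq A v β nb mβ r with anchored? (components A) v
  ... | yes (β′ , mβ′ , r′) with marked-unique nb mβ′ mβ (conn-sym r′ ◅◅ r)
  ... | P.refl = refl
  boundaryValue-eq A v β nb mβ r | no ¬anch = ⊥-elim (¬anch (β , mβ , r))

  potential-extension : ∀ A → ¬ Bad (Conn A) → ∀ v → potential (extension A) v ≈ boundaryValue A v
  potential-extension A nb v with isB v in mv
  ... | false = refl
  ... | true  = trans (*-identityʳ (u v)) (sym (boundaryValue-eq A v v nb mv ε))

  boundaryValue-const : ∀ A → ¬ Bad (Conn A) → ∀ p q → Conn A p q → boundaryValue A p ≈ boundaryValue A q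
  boundaryValue-const A nb p q r with anchored? (components A) p
  ... | yes (β , mβ , rβ) = sym (boundaryValue-eq A q β nb mβ (conn-sym r ◅◅ rβ))
  ... | no ¬anch with anchored? (components A) q
  ... | yes (β , mβ , rβ) = ⊥-elim (¬anch (β , mβ , r ◅◅ rβ))
  ... | no _ = refl

  extension-annihilates : ∀ A → ¬ Bad (Conn A) → Annihilates (extension A) (false ∷ A)
  extension-annihilates A nb zero ()
  extension-annihilates A nb (suc e) l = constant⇒annihilates (extension A) A const e l
    where
    const : ∀ p q → Conn A p q → potential (extension A) p ≈ potential (extension A) q
    const p q r = trans (potential-extension A nb p)
      (trans (boundaryValue-const A nb p q r) (sym (potential-extension A nb q)))

  extension-e₀ : ∀ A → ¬ (pair (extension A) (vec zero) ≈ 0#)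
  extension-e₀ A z = 1≉0 (trans (sym (pair-δ (extension A) nothing)) z)

  bad-does : ∀ A → Bad (Conn A) → does (bad? (components A)) ≡ true
  bad-does A bad with bad? (components A)
  ... | yes _   = P.refl
  ... | no ¬bad = ⊥-elim (¬bad bad)

  ¬bad-does : ∀ A → ¬ Bad (Conn A) → does (bad? (components A)) ≡ false
  ¬bad-does A ¬bad with bad? (components A)
  ... | yes bad = ⊥-elim (¬bad bad)
  ... | no _    = P.refl

  rank-bad : ∀ A → Bad (Conn A) → deficit (components A) +ℕ 1 ≡ rankOf (false ∷ A)
  rank-bad A bad = P.cong (λ z → deficit (components A) +ℕ ind z) (P.sym (bad-does A bad))

  rank-¬bad : ∀ A → ¬ Bad (Conn A) → deficit (components A) +ℕ 1 ≡ suc (rankOf (false ∷ A))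
  rank-¬bad A ¬bad = P.trans (+-suc _ 0)
    (P.cong (λ z → suc (deficit (components A) +ℕ ind z)) (P.sym (¬bad-does A ¬bad)))

  data Growth (S : Subset (suc m)) (x : Fin (suc m)) : Set (c ⊔ ℓ) where
    spanned   : rankOf (S [ x ]≔ true) ≡ rankOf S → InSpan S (vec x) → Growth S x
    separated : rankOf (S [ x ]≔ true) ≡ suc (rankOf S) →
                (φ : Vect) → Annihilates φ S → ¬ (pair φ (vec x) ≈ 0#) → Growth S x

  growth-e₀ : ∀ A → Growth (false ∷ A) zero
  growth-e₀ A = by (bad? (components A))
    where
    by : Dec (Bad (Conn A)) → Growth (false ∷ A) zero
    by (yes bad) = spanned (rank-bad A bad) (bad-spans-e₀ false A bad)
    by (no ¬bad) = separated (rank-¬bad A ¬bad) (extension A) (extension-annihilates A ¬bad) (extension-e₀ A)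

  module AddEdge (t : Bool) (A : Subset m) (e : Fin m) where
    A′ : Subset m
    A′ = A [ e ]≔ true
    a b : Fin n
    a = proj₁ (ends e)
    b = proj₂ (ends e)

    open Coarsen (components A) (components A′) (conn-mono (∈-insert⁺ A e))

    join : Joins a b
    join = conn-insert A e

    rank-cong : ∀ {d d′ x x′} → d ≡ d′ → x ≡ x′ → d +ℕ ind (t ∨ x) ≡ d′ +ℕ ind (t ∨ x′)
    rank-cong P.refl P.refl = P.refl

    already-connected : Conn A a b → Growth (t ∷ A) (suc e)
    already-connected r = spanned (rank-cong deficit′ bad′) (span-edge⁺ (t ∷ A) e (conn-span t A r))
      where
      A′⊆A : ∀ {v w} → Conn A′ v w → Conn A v w
      A′⊆A r′ with join r′
      ... | inj₁ x = x
      ... | inj₂ (inj₁ (c₁ , c₂)) = c₁ ◅◅ r ◅◅ c₂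
      ... | inj₂ (inj₂ (c₁ , c₂)) = c₁ ◅◅ conn-sym r ◅◅ c₂
      deficit′ : deficit (components A′) ≡ deficit (components A)
      deficit′ = proj₁ (coarsen-trivial A′⊆A)
      bad′ : does (bad? (components A′)) ≡ does (bad? (components A))
      bad′ = proj₂ (coarsen-trivial A′⊆A)

    free-end : ∀ c → Free (Conn A) c →
               ¬ (potential (indicator A c) a ≈ potential (indicator A c) b) →
               deficit (components A′) ≡ suc (deficit (components A)) ×
               does (bad? (components A′)) ≡ does (bad? (components A)) →
               Growth (t ∷ A) (suc e)
    free-end c fc separates (deficit′ , bad′) =
      separated (rank-cong deficit′ bad′) (indicator A c) (indicator-annihilates t A c fc)
                (edge-nonvanishing (indicator A c) e separates)

    anchored-ends : ¬ Conn A a b → Anchored (Conn A) a → Anchored (Conn A) b → Growth (t ∷ A) (suc e)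
    anchored-ends ¬ab anch-a@(α , mα , aα) anch-b@(β , mβ , bβ) = by t (bad? (components A))
      where
      joined : deficit (components A′) ≡ deficit (components A) × Bad (Conn A′)
      joined = Join.joinAnchored a b join (conn-edge A e) ¬ab anch-a anch-b
      -- A′ is bad, so its rank is deficit + 1 with or without e₀
      rank′ : ∀ t → rankOf (t ∷ A′) ≡ deficit (components A) +ℕ 1
      rank′ t = P.cong₂ _+ℕ_ (proj₁ joined)
        (P.cong ind (P.trans (P.cong (t ∨_) (bad-does A′ (proj₂ joined))) (∨-zeroʳ t)))
      -- if e₀ is spanned then so is e: π a − π α, π α − π β and π β − π b are
      through-boundary : ∀ t → InSpan (t ∷ A) (δ nothing) → InSpan (t ∷ A) (vec (suc e))
      through-boundary t e₀∈ = span-edge⁺ (t ∷ A) e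
        (span-cong (λ x → trans (+-congˡ (diff-trans (π α x) (π β x) (π b x))) (diff-trans (π a x) (π α x) (π b x)))
          (span-+ (conn-span t A aα) (span-+ (boundary-span e₀∈ mα mβ) (conn-span t A (conn-sym bβ)))))
      -- e is spanned if e₀ ∈ S or A is bad; otherwise the extension separates it,
      -- its potentials at a and b being u α ≠ u β
      by : ∀ t → Dec (Bad (Conn A)) → Growth (t ∷ A) (suc e)
      by true  _ = spanned (rank′ true) (through-boundary true (span-gen (true ∷ A) zero P.refl))
      by false (yes bad) = spanned (P.trans (rank′ false) (rank-bad A bad))
                                   (through-boundary false (bad-spans-e₀ false A bad))
      by false (no ¬bad) = separated (P.trans (rank′ false) (rank-¬bad A ¬bad)) (extension A) (extension-annihilates A ¬bad)
        (edge-nonvanishing (extension A) e λ eq → u-separates mα mβ (λ { P.refl → ¬ab (aα ◅◅ conn-sym bβ) })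
          (x≈y⇒x∙y⁻¹≈ε (begin
            u α                           ≈⟨ sym (boundaryValue-eq A a α ¬bad mα aα) ⟩
            boundaryValue A a             ≈⟨ sym (potential-extension A ¬bad a) ⟩
            potential (extension A) a     ≈⟨ eq ⟩
            potential (extension A) b     ≈⟨ potential-extension A ¬bad b ⟩
            boundaryValue A b             ≈⟨ boundaryValue-eq A b β ¬bad mβ bβ ⟩
            u β                           ∎)))

    growth-edge : Growth (t ∷ A) (suc e)
    growth-edge = by (conn? A a b) (anchored? (components A) a) (anchored? (components A) b)
      where
      by : Dec (Conn A a b) → Dec (Anchored (Conn A) a) → Dec (Anchored (Conn A) b) → Growth (t ∷ A) (suc e)
      by (yes ab) _ _ = already-connected ab
      by (no ¬ab) (no ¬anch-a) _ = free-end a fa (indicator-separates A a b fa ¬ab)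
        (Join.joinFree a b join (conn-edge A e) ¬ab fa)
        where
        fa : Free (Conn A) a
        fa = ¬anchored⇒free (components A) ¬anch-a
      by (no ¬ab) (yes _) (no ¬anch-b) = free-end b fb (λ eq → indicator-separates A b a fb (¬ab ∘ conn-sym) (sym eq))
        (Join.joinFree b a (joins-swap join) (conn-sym (conn-edge A e)) (¬ab ∘ conn-sym) fb)
        where
        fb : Free (Conn A) b
        fb = ¬anchored⇒free (components A) ¬anch-b
      by (no ¬ab) (yes anch-a) (yes anch-b) = anchored-ends ¬ab anch-a anch-b

  growth : ∀ S x → lookup S x ≡ false → Growth S x
  growth (false ∷ A) zero    P.refl = growth-e₀ A
  growth (t ∷ A)     (suc e) _      = AddEdge.growth-edge t A e

  _⊑_ : Subset (suc m) → Subset (suc m) → Set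
  T ⊑ S = ∀ g → lookup T g ≡ true → lookup S g ≡ true

  rankOf-empty : rankOf (replicate (suc m) false) ≡ 0
  rankOf-empty = P.cong₂ _+ℕ_ no-deficit (P.cong ind (¬bad-does _ no-bad-pair))
    where
    empty-rep : ∀ v → isB v ≡ false → Rep (Conn (replicate m false)) v
    empty-rep v mv = (λ w r → P.subst (λ z → isB z ≡ false) (conn-empty r) mv) ,
                     (λ w lt r → <-irrefl (conn-empty r) lt)
    no-deficit : deficit (components (replicate m false)) ≡ 0
    no-deficit = P.trans (count-ext _ (λ _ → false) nonrep) (count-false n)
      where
      nonrep : ∀ v → nonRep (components (replicate m false)) v ≡ false
      nonrep v with isB v in mv
      ... | true = P.refl
      ... | false with rep? (components (replicate m false)) v
      ... | yes _ = P.refl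
      ... | no ¬rep = ⊥-elim (¬rep (empty-rep v mv))
      count-false : ∀ k → count {k} (λ _ → false) ≡ 0
      count-false zero    = P.refl
      count-false (suc k) = count-false k
    no-bad-pair : ¬ Bad (Conn (replicate m false))
    no-bad-pair (_ , _ , _ , _ , α≢β , r) = α≢β (conn-empty r)

  independent-bound : ∀ T → Independent T → ∣ T ∣ ≤ rankOf T
  independent-bound = insertion-induction (λ T → Independent T → ∣ T ∣ ≤ rankOf T) empty insert
    where
    empty : Independent (replicate (suc m) false) → ∣ replicate (suc m) false ∣ ≤ rankOf (replicate (suc m) false)
    empty _ rewrite ∣⊥∣≡0 (suc m) = z≤n
    insert : ∀ T x → lookup T x ≡ false → (Independent T → ∣ T ∣ ≤ rankOf T) →
             Independent (T [ x ]≔ true) → ∣ T [ x ]≔ true ∣ ≤ rankOf (T [ x ]≔ true)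
    insert T x x∉T ih ind′ with growth T x x∉T
    ... | spanned _ sp = ⊥-elim (span⇒dependent T x x∉T sp ind′)
    ... | separated grows _ _ _ rewrite ∣insert∣ T x x∉T | grows =
      s≤s (ih (indep-sub T (T [ x ]≔ true) (∈-insert⁺ T x) ind′))

  Basis : Subset (suc m) → Set (c ⊔ ℓ)
  Basis S = Σ (Subset (suc m)) λ B → B ⊑ S × Independent B × ∣ B ∣ ≡ rankOf S

  basis : ∀ S → Basis S
  basis = insertion-induction Basis empty insert
    where
    empty : Basis (replicate (suc m) false)
    empty = replicate (suc m) false , (λ g l → l) , indep-empty , P.trans (∣⊥∣≡0 (suc m)) (P.sym rankOf-empty)
    insert : ∀ S x → lookup S x ≡ false → Basis S → Basis (S [ x ]≔ true)
    insert S x x∉S (B , B⊑S , indB , size) with growth S x x∉S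
    ... | spanned same _ = B , (λ g l → ∈-insert⁺ S x g (B⊑S g l)) , indB , P.trans size (P.sym same)
    ... | separated grows φ ann nz =
      B [ x ]≔ true , B+x⊑S+x , indep-insert B x φ indB x∉B (λ g l → ann g (B⊑S g l)) nz ,
      P.trans (∣insert∣ B x x∉B) (P.trans (P.cong suc size) (P.sym grows))
      where
      x∉B : lookup B x ≡ false
      x∉B with lookup B x in eq
      ... | false = P.refl
      ... | true  = P.trans (P.sym (B⊑S x eq)) x∉S
      B+x⊑S+x : (B [ x ]≔ true) ⊑ (S [ x ]≔ true)
      B+x⊑S+x g l with ∈-insert⁻ B x g l
      ... | inj₁ P.refl = lookup∘update x S true
      ... | inj₂ g∈B    = ∈-insert⁺ S x g (B⊑S g g∈B)

  -- rankOf is monotone: representatives only disappear and badness persists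
  rankOf-mono : ∀ T S → T ⊑ S → rankOf T ≤ rankOf S
  rankOf-mono (t ∷ A) (s ∷ A′) T⊑S = +-mono-≤ (count-mono _ _ nonRep-mono) (ind-mono (grows t s (T⊑S zero)))
    where
    open Coarsen (components A) (components A′) (conn-mono (λ e → T⊑S (suc e)))
    nonRep-mono : ∀ v → nonRep (components A) v ≡ true → nonRep (components A′) v ≡ true
    nonRep-mono v with isB v | rep? (components A) v | rep? (components A′) v
    ... | false | no ¬rep | yes rep′ = λ _ → ⊥-elim (¬rep (rep-anti rep′))
    ... | false | no _    | no _     = λ _ → P.refl
    ... | false | yes _   | _        = λ ()
    ... | true  | _       | _        = λ ()
    grows : ∀ t s → (t ≡ true → s ≡ true) →
            (t ∨ does (bad? (components A))) ≡ true → (s ∨ does (bad? (components A′))) ≡ true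
    grows _ true _ _ = P.refl
    grows true false h _ with h P.refl
    ... | ()
    grows false false _ with bad? (components A) | bad? (components A′)
    ... | _         | yes _   = λ _ → P.refl
    ... | yes bad   | no ¬bad = λ _ → ⊥-elim (¬bad (bad-mono bad))
    ... | no _      | no _    = λ ()

  rank-formula : (ρ : Subset (suc m) → ℕ) → (∀ S → IsRank S (ρ S)) → ∀ S → ρ S ≡ rankOf S
  rank-formula ρ isRank S = ≤-antisym upper lower
    where
    ⊆⇒⊑ : ∀ {T S} → T ⊆ S → T ⊑ S
    ⊆⇒⊑ {T} {S} h g l = []=⇒lookup (h (lookup⇒[]= g T l))
    ⊑⇒⊆ : ∀ {T S} → T ⊑ S → T ⊆ S
    ⊑⇒⊆ {T} {S} h {g} g∈T = lookup⇒[]= g S (h g ([]=⇒lookup g∈T))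
    upper : ρ S ≤ rankOf S
    upper with proj₁ (isRank S)
    ... | T , T⊆S , indT , size =
      P.subst (_≤ rankOf S) size (≤-trans (independent-bound T indT) (rankOf-mono T S (⊆⇒⊑ T⊆S)))
    lower : rankOf S ≤ ρ S
    lower with basis S
    ... | B , B⊑S , indB , size = P.subst (_≤ ρ S) size (proj₂ (isRank S) B (⊑⇒⊆ B⊑S) indB)

module SequenceCounting where

  open Subsets using (ind; count)
  open import Data.Nat using (zero; suc; _+_; _*_; _^_; s≤s)
  open import Data.Nat.Properties using (+-assoc; *-zeroʳ; +-identityʳ)
  open import Data.Bool using (Bool; true; false; if_then_else_; _∨_)
  open import Data.Fin using (zero; suc; _<_; _≟_)
  open import Data.Vec using (Vec; _∷_; lookup; replicate)
  open import Data.List using (List; []; _∷_; map; concat; length; filterᵇ; tabulate; _++_)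
  open import Data.Empty using (⊥-elim)
  open import Function using (_∘_; id)
  open import Relation.Nullary using (yes; no; does)
  open import Relation.Binary.PropositionalEquality using (_≡_; refl; sym; trans; cong; cong₂)

  countL : ∀ {A : Set} → (A → Bool) → List A → ℕ
  countL g L = length (filterᵇ g L)

  countL-∷ : ∀ {A : Set} (g : A → Bool) x L → countL g (x ∷ L) ≡ ind (g x) + countL g L
  countL-∷ g x L with g x
  ... | true  = refl
  ... | false = refl

  countL-++ : ∀ {A : Set} (g : A → Bool) xs ys → countL g (xs ++ ys) ≡ countL g xs + countL g ys
  countL-++ g []       ys = refl
  countL-++ g (x ∷ xs) ys = trans (countL-∷ g x (xs ++ ys)) (trans (cong (ind (g x) +_) (countL-++ g xs ys))
    (trans (sym (+-assoc (ind (g x)) _ _)) (cong (_+ countL g ys) (sym (countL-∷ g x xs)))))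

  countL-map : ∀ {A B : Set} (g : B → Bool) (h : A → B) L → countL g (map h L) ≡ countL (g ∘ h) L
  countL-map g h []      = refl
  countL-map g h (x ∷ L) = trans (countL-∷ g (h x) (map h L))
    (trans (cong (ind (g (h x)) +_) (countL-map g h L)) (sym (countL-∷ (g ∘ h) x L)))

  countL-ext : ∀ {A : Set} (g h : A → Bool) → (∀ x → g x ≡ h x) → ∀ L → countL g L ≡ countL h L
  countL-ext g h eq []      = refl
  countL-ext g h eq (x ∷ L) = trans (countL-∷ g x L)
    (trans (cong₂ _+_ (cong ind (eq x)) (countL-ext g h eq L)) (sym (countL-∷ h x L)))

  countL-false : ∀ {A : Set} (L : List A) → countL (λ _ → false) L ≡ 0
  countL-false []      = refl
  countL-false (x ∷ L) = countL-false L

  sumℕ : ∀ {k} → (Fin k → ℕ) → ℕ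
  sumℕ {zero}  h = 0
  sumℕ {suc k} h = h zero + sumℕ (h ∘ suc)

  sumℕ-ext : ∀ {k} (g h : Fin k → ℕ) → (∀ x → g x ≡ h x) → sumℕ g ≡ sumℕ h
  sumℕ-ext {zero}  g h eq = refl
  sumℕ-ext {suc k} g h eq = cong₂ _+_ (eq zero) (sumℕ-ext (g ∘ suc) (h ∘ suc) (eq ∘ suc))

  sumℕ-const : ∀ k c → sumℕ {k} (λ _ → c) ≡ k * c
  sumℕ-const zero    c = refl
  sumℕ-const (suc k) c = cong (c +_) (sumℕ-const k c)

  sumℕ-single : ∀ {k} (c₀ : Fin k) X → sumℕ (λ x → if does (x ≟ c₀) then X else 0) ≡ X
  sumℕ-single {suc k} zero X =
    trans (cong (X +_) (trans (sumℕ-const k 0) (*-zeroʳ k))) (+-identityʳ X)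
  sumℕ-single {suc k} (suc c₀) X = trans (sumℕ-ext _ _ shift) (sumℕ-single c₀ X)
    where
    shift : ∀ x → (if does (suc x ≟ suc c₀) then X else 0) ≡ (if does (x ≟ c₀) then X else 0)
    shift x with x ≟ c₀
    ... | yes refl = refl
    ... | no _     = refl

  countL-concat : ∀ {A B : Set} {k} (g : B → Bool) (h : A → List B) (φ : Fin k → A) →
                  countL g (concat (map h (tabulate φ))) ≡ sumℕ (λ x → countL g (h (φ x)))
  countL-concat {k = zero}  g h φ = refl
  countL-concat {k = suc k} g h φ =
    trans (countL-++ g (h (φ zero)) _) (cong (countL g (h (φ zero)) +_) (countL-concat g h (φ ∘ suc)))

  allF : ∀ {m} → (Fin m → Bool) → Bool
  allF {zero}  p = true
  allF {suc m} p = if p zero then allF (p ∘ suc) else false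

  allᵇ-tabulate : ∀ {A : Set} {m} (p : A → Bool) (g : Fin m → A) → allᵇ p (tabulate g) ≡ allF (p ∘ g)
  allᵇ-tabulate {m = zero}  p g = refl
  allᵇ-tabulate {m = suc m} p g with p (g zero)
  ... | true  = allᵇ-tabulate p (g ∘ suc)
  ... | false = refl

  allF-elim : ∀ {m} (p : Fin m → Bool) → allF p ≡ true → ∀ j → p j ≡ true
  allF-elim {suc m} p h j with p zero in eq
  allF-elim {suc m} p h zero    | true = eq
  allF-elim {suc m} p h (suc j) | true = allF-elim (p ∘ suc) h j
  allF-elim {suc m} p () j | false

  allF-intro : ∀ {m} (p : Fin m → Bool) → (∀ j → p j ≡ true) → allF p ≡ true
  allF-intro {zero}  p h = refl
  allF-intro {suc m} p h rewrite h zero = allF-intro (p ∘ suc) (h ∘ suc)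

  -- Sequences κ ∈ (Fin k)ⁿ in which each position j is either free or forced
  -- to equal target j κ, a colour depending only on earlier positions.  There
  -- are k^(#free) of them.
  Respects : ∀ {k n} → (Fin n → Bool) → (Fin n → Vec (Fin k) n → Fin k) → Vec (Fin k) n → Bool
  Respects free target κ = allF (λ j → free j ∨ does (lookup κ j ≟ target j κ))

  Causal : ∀ {k n} → (Fin n → Bool) → (Fin n → Vec (Fin k) n → Fin k) → Set
  Causal {k} {n} free target = ∀ j → free j ≡ false → ∀ κ κ′ →
    (∀ i → i < j → lookup κ i ≡ lookup κ′ i) → target j κ ≡ target j κ′

  -- (a colour c₀ is needed: for k = 0 there are no sequences at all)
  count-forced : ∀ {k} (c₀ : Fin k) n (free : Fin n → Bool) (target : Fin n → Vec (Fin k) n → Fin k) → Causal free target →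
                 countL (Respects free target) (allVecs k n) ≡ k ^ count free
  count-forced c₀ zero    free target causal = refl
  count-forced {k} c₀ (suc n) free target causal =
    trans (countL-concat (Respects free target) (λ x → map (x ∷_) (allVecs k n)) id)
          (trans (sumℕ-ext _ _ (λ x → countL-map (Respects free target) (x ∷_) (allVecs k n)))
                 (by-first (free zero) refl))
    where
    target′ : Fin k → Fin n → Vec (Fin k) n → Fin k
    target′ x j κ = target (suc j) (x ∷ κ)
    causal′ : ∀ x → Causal (free ∘ suc) (target′ x)
    causal′ x j fj κ κ′ agree = causal (suc j) fj (x ∷ κ) (x ∷ κ′) agree′
      where
      agree′ : ∀ i → i < suc j → lookup (x ∷ κ) i ≡ lookup (x ∷ κ′) i
      agree′ zero    _        = refl
      agree′ (suc i) (s≤s lt) = agree i lt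
    rest : ∀ x → countL (Respects (free ∘ suc) (target′ x)) (allVecs k n) ≡ k ^ count (free ∘ suc)
    rest x = count-forced c₀ n (free ∘ suc) (target′ x) (causal′ x)
    by-first : ∀ b → free zero ≡ b →
               sumℕ (λ x → countL (Respects free target ∘ (x ∷_)) (allVecs k n)) ≡ k ^ count free
    by-first true fz =
      trans (sumℕ-ext _ (λ _ → k ^ count (free ∘ suc)) each)
            (trans (sumℕ-const k _) (cong (λ z → k ^ (ind z + count (free ∘ suc))) (sym fz)))
      where
      each : ∀ x → countL (Respects free target ∘ (x ∷_)) (allVecs k n) ≡ k ^ count (free ∘ suc)
      each x = trans (countL-ext _ _ same (allVecs k n)) (rest x)
        where
        same : ∀ κ → Respects free target (x ∷ κ) ≡ Respects (free ∘ suc) (target′ x) κ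
        same κ rewrite fz = refl
    by-first false fz =
      trans (sumℕ-ext _ (λ x → if does (x ≟ forced) then k ^ count (free ∘ suc) else 0) each)
            (trans (sumℕ-single forced _) (cong (λ z → k ^ (ind z + count (free ∘ suc))) (sym fz)))
      where
      forced : Fin k
      forced = target zero (replicate (suc n) c₀)
      is-forced : ∀ κ → target zero κ ≡ forced
      is-forced κ = causal zero fz κ (replicate (suc n) c₀) (λ i ())
      each : ∀ x → countL (Respects free target ∘ (x ∷_)) (allVecs k n) ≡
                   (if does (x ≟ forced) then k ^ count (free ∘ suc) else 0)
      each x with x ≟ forced
      ... | yes refl = trans (countL-ext _ _ same (allVecs k n)) (rest x)
        where
        same : ∀ κ → Respects free target (x ∷ κ) ≡ Respects (free ∘ suc) (target′ x) κ
        same κ rewrite fz | is-forced (x ∷ κ) with x ≟ x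
        ... | yes _ = refl
        ... | no ne = ⊥-elim (ne refl)
      ... | no ne = trans (countL-ext _ _ none (allVecs k n)) (countL-false (allVecs k n))
        where
        none : ∀ κ → Respects free target (x ∷ κ) ≡ false
        none κ rewrite fz | is-forced (x ∷ κ) with x ≟ forced
        ... | yes eq = ⊥-elim (ne eq)
        ... | no _   = refl

module SubsetSums where

  open Subsets using (ind)
  open SequenceCounting using (allF)
  open import Data.Nat using (zero; suc)
  open import Data.Fin using () renaming (zero to fzero; suc to fsuc)
  open import Data.Bool using (Bool; true; false; not; _∨_)
  open import Data.Fin.Subset using (Subset; ∣_∣; inside; outside)
  open import Data.Vec using ([]; _∷_; lookup)
  open import Data.Integer using (ℤ; +_; -_; _+_; _*_; _^_)
  open import Data.Integer.Properties using (*-distribˡ-+; *-zeroʳ; *-assoc; -1*i≡-i; +-inverseʳ; +-identityʳ; +-commutativeSemigroup)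
  open import Function using (_∘_)
  open import Relation.Binary.PropositionalEquality using (refl; sym; trans; cong; cong₂)

  sgn : ∀ {j} → Subset j → ℤ
  sgn S = (- (+ 1)) ^ ∣ S ∣

  sumSubsets-cong : ∀ j (g h : Subset j → ℤ) → (∀ S → g S ≡ h S) → sumSubsets j g ≡ sumSubsets j h
  sumSubsets-cong zero    g h eq = eq []
  sumSubsets-cong (suc j) g h eq =
    cong₂ _+_ (sumSubsets-cong j _ _ (eq ∘ (outside ∷_))) (sumSubsets-cong j _ _ (eq ∘ (inside ∷_)))

  sumSubsets-+ : ∀ j (g h : Subset j → ℤ) → sumSubsets j (λ S → g S + h S) ≡ sumSubsets j g + sumSubsets j h
  sumSubsets-+ zero    g h = refl
  sumSubsets-+ (suc j) g h =
    trans (cong₂ _+_ (sumSubsets-+ j (g ∘ (outside ∷_)) (h ∘ (outside ∷_))) (sumSubsets-+ j (g ∘ (inside ∷_)) (h ∘ (inside ∷_))))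
          (interchange (sumSubsets j (g ∘ (outside ∷_))) (sumSubsets j (h ∘ (outside ∷_)))
                       (sumSubsets j (g ∘ (inside ∷_))) (sumSubsets j (h ∘ (inside ∷_))))
    where open import Algebra.Properties.CommutativeSemigroup +-commutativeSemigroup using (interchange)

  sumSubsets-* : ∀ j (c : ℤ) (g : Subset j → ℤ) → sumSubsets j (λ S → c * g S) ≡ c * sumSubsets j g
  sumSubsets-* zero    c g = refl
  sumSubsets-* (suc j) c g = trans (cong₂ _+_ (sumSubsets-* j c _) (sumSubsets-* j c _)) (sym (*-distribˡ-+ c _ _))

  sumSubsets-0 : ∀ j → sumSubsets j (λ _ → + 0) ≡ + 0
  sumSubsets-0 zero    = refl
  sumSubsets-0 (suc j) = cong₂ _+_ (sumSubsets-0 j) (sumSubsets-0 j)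

  -- Σ_{A ⊆ Q} (−1)^|A| = [Q = ∅], for Q = {e | q e}
  alternating-sum : ∀ j (q : Fin j → Bool) →
    sumSubsets j (λ A → sgn A * + ind (allF (λ e → not (lookup A e) ∨ q e))) ≡ + ind (allF (not ∘ q))
  alternating-sum zero q = refl
  alternating-sum (suc j) q with q fzero
  ... | true = trans (cong (λ z → X + z) (trans (sumSubsets-cong j _ _ (λ A → *-assoc (- (+ 1)) (sgn A) _))
                                         (sumSubsets-* j (- (+ 1)) _)))
                     (trans (cong (λ z → z + (- (+ 1)) * z) (alternating-sum j (q ∘ fsuc))) (cancel (+ ind (allF (not ∘ (q ∘ fsuc))))))
    where
    X : ℤ
    X = sumSubsets j (λ A → sgn A * + ind (allF (λ e → not (lookup A e) ∨ q (fsuc e))))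
    cancel : ∀ x → x + (- (+ 1)) * x ≡ + 0
    cancel x = trans (cong (λ z → x + z) (-1*i≡-i x)) (+-inverseʳ x)
  ... | false = trans (cong (λ z → X + z) (trans (sumSubsets-cong j _ _ (λ A → *-zeroʳ (- (+ 1) * sgn A))) (sumSubsets-0 j)))
                      (trans (+-identityʳ X) (alternating-sum j (q ∘ fsuc)))
    where
    X : ℤ
    X = sumSubsets j (λ A → sgn A * + ind (allF (λ e → not (lookup A e) ∨ q (fsuc e))))

module Colourings (N : Network) (k : ℕ) (col : Fin (Network.n N) → Fin k)
    (col-injective : ∀ i j → Network.isB N i ≡ true → Network.isB N j ≡ true → col i ≡ col j → i ≡ j) where

  open Subsets
  open Network N
  open Connectivity ends
  open Components.Marked isB
  open SequenceCounting
  open SubsetSums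
  open import Data.Nat using (_^_) renaming (_+_ to _+ℕ_)
  open import Data.Integer using (+_; _+_; _*_)
  open import Data.Integer.Properties using (*-zeroʳ; *-distribˡ-+; pos-+)
  open import Relation.Binary.PropositionalEquality.Properties using (module ≡-Reasoning)
  open ≡-Reasoning
  open import Data.Nat.Properties using (≮⇒≥)
  open import Data.Bool using (Bool; true; false; if_then_else_; not; _∨_)
  open import Data.Fin using (_<_; _≟_)
  open import Data.Fin.Properties using (≤∧≢⇒<)
  open import Data.Fin.Subset using (Subset)
  open import Data.Vec using (Vec; lookup)
  open import Data.List using ([]; _∷_; allFin)
  open import Data.Product using (_,_; proj₁; proj₂)
  open import Data.Sum using (inj₁; inj₂)
  open import Data.Empty using (⊥-elim)
  open import Function using (_∘_; id)
  open import Relation.Nullary using (¬_; Dec; yes; no; does)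
  open import Relation.Binary.Construct.Closure.ReflexiveTransitive using (ε; _◅_; _◅◅_)
  open import Relation.Binary.PropositionalEquality using (_≢_; refl; sym; trans; cong; cong₂; subst)

  sameColour : Vec (Fin k) n → Fin m → Bool
  sameColour κ e = does (lookup κ (proj₁ (ends e)) ≟ lookup κ (proj₂ (ends e)))

  agreesAt : Vec (Fin k) n → Fin n → Bool
  agreesAt κ v = if isB v then does (lookup κ v ≟ col v) else true

  agrees : Vec (Fin k) n → Bool
  agrees κ = allᵇ (agreesAt κ) (allFin n)

  proper : Vec (Fin k) n → Bool
  proper κ = allᵇ (λ e → not (sameColour κ e)) (allFin m)

  good : Vec (Fin k) n → Bool
  good κ = if proper κ then agrees κ else false

  constantOn : Subset m → Vec (Fin k) n → Bool
  constantOn A κ = allF (λ e → not (lookup A e) ∨ sameColour κ e)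

  goodOn : Subset m → Vec (Fin k) n → Bool
  goodOn A κ = if agrees κ then constantOn A κ else false

  colourings : Subset m → ℕ
  colourings A = countL (goodOn A) (allVecs k n)

  Agrees : Vec (Fin k) n → Set
  Agrees κ = ∀ v → isB v ≡ true → lookup κ v ≡ col v

  ConstantOn : Subset m → Vec (Fin k) n → Set
  ConstantOn A κ = ∀ e → lookup A e ≡ true → lookup κ (proj₁ (ends e)) ≡ lookup κ (proj₂ (ends e))

  agrees-sound : ∀ κ → agrees κ ≡ true → Agrees κ
  agrees-sound κ h v mv with allF-elim (agreesAt κ) (trans (sym (allᵇ-tabulate (agreesAt κ) id)) h) v
  ... | at-v rewrite mv with lookup κ v ≟ col v
  ... | yes eq = eq
  agrees-sound κ h v mv | () | no _

  agrees-complete : ∀ κ → Agrees κ → agrees κ ≡ true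
  agrees-complete κ h = trans (allᵇ-tabulate (agreesAt κ) id) (allF-intro _ at)
    where
    at : ∀ v → agreesAt κ v ≡ true
    at v with isB v in mv
    ... | false = refl
    ... | true with lookup κ v ≟ col v
    ... | yes _ = refl
    ... | no ne = ⊥-elim (ne (h v mv))

  constantOn-sound : ∀ A κ → constantOn A κ ≡ true → ConstantOn A κ
  constantOn-sound A κ h e l with allF-elim _ h e
  ... | at-e rewrite l with lookup κ (proj₁ (ends e)) ≟ lookup κ (proj₂ (ends e))
  ... | yes eq = eq
  constantOn-sound A κ h e l | () | no _

  constantOn-complete : ∀ A κ → ConstantOn A κ → constantOn A κ ≡ true
  constantOn-complete A κ h = allF-intro _ at
    where
    at : ∀ e → (not (lookup A e) ∨ sameColour κ e) ≡ true
    at e with lookup A e in l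
    ... | false = refl
    ... | true with lookup κ (proj₁ (ends e)) ≟ lookup κ (proj₂ (ends e))
    ... | yes _ = refl
    ... | no ne = ⊥-elim (ne (h e l))

  goodOn-sound : ∀ A κ → goodOn A κ ≡ true → Agrees κ × ConstantOn A κ
  goodOn-sound A κ h with agrees κ in eq
  ... | true = agrees-sound κ eq , constantOn-sound A κ h
  goodOn-sound A κ () | false

  goodOn-complete : ∀ A κ → Agrees κ → ConstantOn A κ → goodOn A κ ≡ true
  goodOn-complete A κ ag ct rewrite agrees-complete κ ag = constantOn-complete A κ ct

  constant-conn : ∀ A κ → ConstantOn A κ → ∀ {v w} → Conn A v w → lookup κ v ≡ lookup κ w
  constant-conn A κ ct ε = refl
  constant-conn A κ ct (step e l s ◅ p) = trans (along s (ct e l)) (constant-conn A κ ct p)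
    where
    along : ∀ {v v′} → SameEnds (ends e) (v , v′) → lookup κ (proj₁ (ends e)) ≡ lookup κ (proj₂ (ends e)) →
            lookup κ v ≡ lookup κ v′
    along (inj₁ (refl , refl)) h = h
    along (inj₂ (refl , refl)) h = sym h

  -- if A is bad, no colouring is good on A: two distinct boundary nodes
  -- would receive the same colour
  colourings-bad : ∀ A → Bad (Conn A) → colourings A ≡ 0
  colourings-bad A (α , β , mα , mβ , α≢β , r) = trans (countL-ext _ _ none (allVecs k n)) (countL-false (allVecs k n))
    where
    none : ∀ κ → goodOn A κ ≡ false
    none κ with goodOn A κ in eq
    ... | false = refl
    ... | true with goodOn-sound A κ eq
    ... | ag , ct = ⊥-elim (α≢β (col-injective α β mα mβ
                      (trans (sym (ag α mα)) (trans (constant-conn A κ ct r) (ag β mβ)))))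

  target : Subset m → Fin n → Vec (Fin k) n → Fin k
  target A v κ with anchored? (components A) v
  ... | yes (β , _ , _) = col β
  ... | no _ = lookup κ (minOf (components A) v)

  isRep : Subset m → Fin n → Bool
  isRep A v = does (rep? (components A) v)

  target-good : ∀ A κ → Agrees κ → ConstantOn A κ → ∀ j → lookup κ j ≡ target A j κ
  target-good A κ ag ct j with anchored? (components A) j
  ... | yes (β , mβ , r) = trans (constant-conn A κ ct r) (ag β mβ)
  ... | no _ = sym (constant-conn A κ ct (minOf-R (components A) j))

  respects-target : ∀ A κ → Respects (isRep A) (target A) κ ≡ true → ∀ j → lookup κ j ≡ target A j κ
  respects-target A κ h j with allF-elim _ h j
  ... | at-j with rep? (components A) j
  ... | no _ with lookup κ j ≟ target A j κ
  ... | yes eq = eq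
  respects-target A κ h j | () | no _ | no _
  respects-target A κ h j | at-j | yes (fj , lj) with anchored? (components A) j
  ... | yes anch = ⊥-elim (free⇒¬anchored (components A) fj anch)
  ... | no _ = cong (lookup κ) (sym (minOf-self (components A) lj))

  target-conn : ∀ A κ → ¬ Bad (Conn A) → ∀ {p q} → Conn A p q → target A p κ ≡ target A q κ
  target-conn A κ ¬bad {p} {q} r with anchored? (components A) p | anchored? (components A) q
  ... | yes (β , mβ , rβ) | yes (β′ , mβ′ , rβ′) = cong col (marked-unique ¬bad mβ mβ′ (conn-sym rβ ◅◅ r ◅◅ rβ′))
  ... | yes (β , mβ , rβ) | no ¬anch = ⊥-elim (¬anch (β , mβ , conn-sym r ◅◅ rβ))
  ... | no ¬anch | yes (β , mβ , rβ) = ⊥-elim (¬anch (β , mβ , r ◅◅ rβ))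
  ... | no _ | no _ = cong (lookup κ) (minOf-cong (components A) r)

  target-boundary : ∀ A κ → ¬ Bad (Conn A) → ∀ v → isB v ≡ true → target A v κ ≡ col v
  target-boundary A κ ¬bad v mv with anchored? (components A) v
  ... | yes (β , mβ , r) = cong col (sym (marked-unique ¬bad mv mβ r))
  ... | no ¬anch = ⊥-elim (¬anch (v , mv , ε))

  good⇔respects : ∀ A → ¬ Bad (Conn A) → ∀ κ → goodOn A κ ≡ Respects (isRep A) (target A) κ
  good⇔respects A ¬bad κ with goodOn A κ in g | Respects (isRep A) (target A) κ in rs
  ... | false | false = refl
  ... | true  | true  = refl
  ... | true  | false with goodOn-sound A κ g
  ... | ag , ct = trans (sym (allF-intro _ at)) rs
    where
    at : ∀ j → (isRep A j ∨ does (lookup κ j ≟ target A j κ)) ≡ true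
    at j with isRep A j
    ... | true = refl
    ... | false with lookup κ j ≟ target A j κ
    ... | yes _ = refl
    ... | no ne = ⊥-elim (ne (target-good A κ ag ct j))
  good⇔respects A ¬bad κ | false | true = trans (sym g) (goodOn-complete A κ ag ct)
    where
    on-target : ∀ j → lookup κ j ≡ target A j κ
    on-target = respects-target A κ rs
    ag : Agrees κ
    ag v mv = trans (on-target v) (target-boundary A κ ¬bad v mv)
    ct : ConstantOn A κ
    ct e l = trans (on-target _)
      (trans (target-conn A κ ¬bad (step e l (inj₁ (refl , refl)) ◅ ε)) (sym (on-target _)))

  target-causal : ∀ A → Causal (isRep A) (target A)
  target-causal A j not-rep κ κ′ agree with anchored? (components A) j
  ... | yes _ = refl
  ... | no ¬anch = agree (minOf (components A) j) earlier
    where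
    fj : Free (Conn A) j
    fj = ¬anchored⇒free (components A) ¬anch
    ¬rep : ¬ Rep (Conn A) j
    ¬rep = by (rep? (components A) j) not-rep
      where
      by : (d : Dec (Rep (Conn A) j)) → does d ≡ false → ¬ Rep (Conn A) j
      by (no ¬r) _ = ¬r
    not-least : minOf (components A) j ≢ j
    not-least eq = ¬rep (fj , subst (Least (Conn A)) eq (minOf-least (components A) j))
    earlier : minOf (components A) j < j
    earlier = ≤∧≢⇒< (≮⇒≥ (minOf-≤ (components A) j j ε)) not-least

  colourings-good : Fin k → ∀ A → ¬ Bad (Conn A) → colourings A ≡ k ^ freeClasses (components A)
  colourings-good c₀ A ¬bad = trans (countL-ext _ _ (good⇔respects A ¬bad) (allVecs k n))
    (count-forced c₀ n (isRep A) (target A) (target-causal A))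

  signed-count : ∀ κ → sumSubsets m (λ A → sgn A * + ind (goodOn A κ)) ≡ + ind (good κ)
  signed-count κ with agrees κ
  ... | false = trans (trans (sumSubsets-cong m _ _ (λ A → *-zeroʳ (sgn A))) (sumSubsets-0 m))
                      (cong (λ z → + ind z) (sym (if-false (proper κ))))
    where
    if-false : ∀ b → (if b then false else false) ≡ false
    if-false true  = refl
    if-false false = refl
  ... | true = trans (alternating-sum m (sameColour κ))
                     (cong (λ z → + ind z) (trans (sym (allᵇ-tabulate (not ∘ sameColour κ) id)) (sym (if-id (proper κ)))))
    where
    if-id : ∀ b → (if b then true else false) ≡ b
    if-id true  = refl
    if-id false = refl

  inclusion-exclusion : ∀ L → + countL good L ≡ sumSubsets m (λ A → sgn A * + countL (goodOn A) L)
  inclusion-exclusion [] = sym (trans (sumSubsets-cong m _ _ (λ A → *-zeroʳ (sgn A))) (sumSubsets-0 m))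
  inclusion-exclusion (κ ∷ L) = sym (begin
    sumSubsets m (λ A → sgn A * + countL (goodOn A) (κ ∷ L))
      ≡⟨ sumSubsets-cong m _ _ (λ A → split (sgn A) (goodOn A κ) (countL (goodOn A) L)
                                             (cong +_ (countL-∷ (goodOn A) κ L))) ⟩
    sumSubsets m (λ A → sgn A * + ind (goodOn A κ) + sgn A * + countL (goodOn A) L)
      ≡⟨ sumSubsets-+ m _ _ ⟩
    sumSubsets m (λ A → sgn A * + ind (goodOn A κ)) + sumSubsets m (λ A → sgn A * + countL (goodOn A) L)
      ≡⟨ cong₂ _+_ (signed-count κ) (sym (inclusion-exclusion L)) ⟩
    + ind (good κ) + + countL good L
      ≡⟨ sym (pos-+ (ind (good κ)) (countL good L)) ⟩
    + (ind (good κ) +ℕ countL good L)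
      ≡⟨ cong +_ (sym (countL-∷ good κ L)) ⟩
    + countL good (κ ∷ L) ∎)
    where
    split : ∀ s b c {t} → t ≡ + (ind b +ℕ c) → s * t ≡ s * + ind b + s * + c
    split s b c refl = trans (cong (s *_) (pos-+ (ind b) c)) (*-distribˡ-+ s _ _)

module CharacteristicPolynomial {c ℓ} (N : Network) (F : Field c ℓ)
    (u : Fin (Network.n N) → Field.Carrier F)
    (u-injective : ∀ i j → Network.isB N i ≡ true → Network.isB N j ≡ true → Field._≈_ F (u i) (u j) → i ≡ j)
    (ρ : Subset (suc (Network.m N)) → ℕ)
    (isRank : ∀ S → DirichletMatroid.IsRank N F u S (ρ S))
    (k : ℕ) (col : Fin (Network.n N) → Fin k)
    (col-injective : ∀ i j → Network.isB N i ≡ true → Network.isB N j ≡ true → col i ≡ col j → i ≡ j) where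

  open Subsets using (count; count-ext)
  open Network N
  open Connectivity ends
  open Components.Marked isB
  open RankFormula N F u u-injective using (rank-formula)
  open Colourings N k col col-injective
  open SubsetSums
  open import Data.Nat using (suc; _∸_) renaming (_+_ to _+ℕ_; _^_ to _^ℕ_)
  open import Data.Nat.Properties using (+-identityʳ; +-assoc; +-comm; m+n∸m≡n; [m+n]∸[m+o]≡n∸o; m+n∸n≡m)
  open import Data.Bool using (true; not)
  open import Data.Bool.Properties using (∧-identityʳ)
  open import Data.Fin.Subset using (Subset; inside; outside; ⊤)
  open import Data.Vec using (_∷_; replicate)
  open import Data.Vec.Properties using (lookup-replicate)
  open import Data.Integer using (ℤ; +_; -_; _+_; _*_; _^_; _-_)
  open import Data.Integer.Properties using (pos-*; *-zeroʳ; *-assoc; -1*i≡-i; +-inverseʳ)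
  open import Data.Product using (_,_; proj₁; proj₂)
  open import Relation.Nullary using (yes; no)
  open import Relation.Binary.Construct.Closure.ReflexiveTransitive using (ε; _◅_)
  open import Relation.Binary.PropositionalEquality using (refl; sym; trans; cong; cong₂)
  open import Relation.Binary.PropositionalEquality.Properties using (module ≡-Reasoning)
  open import Defs using (Walk; []; _∷_)

  K : ℤ
  K = + k

  interior : ℕ
  interior = count (λ v → not (isB v))

  -- Γ is connected and has a boundary node, so with all edges present no
  -- component is free
  E : Subset m
  E = replicate m true

  deficit-E : deficit (components E) ≡ interior
  deficit-E = count-ext _ _ no-rep
    where
    β₀ : Fin n
    β₀ = proj₁ twoBoundary
    mβ₀ : isB β₀ ≡ true
    mβ₀ = proj₁ (proj₂ (proj₂ (proj₂ twoBoundary)))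
    walk⇒conn : ∀ {v w} → Walk ends v w → Conn E v w
    walk⇒conn []       = ε
    walk⇒conn ((e , s) ∷ p) = step e (lookup-replicate e true) s ◅ walk⇒conn p
    no-rep : ∀ v → nonRep (components E) v ≡ not (isB v)
    no-rep v with rep? (components E) v
    ... | no _ = ∧-identityʳ (not (isB v))
    ... | yes (fv , _) with trans (sym mβ₀) (fv β₀ (walk⇒conn (connected v β₀)))
    ... | ()

  rank-E : ρ ⊤ ≡ interior +ℕ 1
  rank-E = trans (rank-formula ρ isRank ⊤) (cong (_+ℕ 1) deficit-E)

  exponent-A : ∀ d f → (d +ℕ f) +ℕ 1 ∸ (d +ℕ 0) ≡ suc f
  exponent-A d f rewrite +-identityʳ d | +-assoc d f 1 | m+n∸m≡n d (f +ℕ 1) = +-comm f 1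

  exponent-A+e₀ : ∀ d f → (d +ℕ f) +ℕ 1 ∸ (d +ℕ 1) ≡ f
  exponent-A+e₀ d f rewrite +-assoc d f 1 | [m+n]∸[m+o]≡n∸o d (f +ℕ 1) 1 = m+n∸n≡m f 1

  pos-^ : ∀ a b → + (a ^ℕ b) ≡ (+ a) ^ b
  pos-^ a 0       = refl
  pos-^ a (suc b) = trans (pos-* a (a ^ℕ b)) (cong (λ z → + a * z) (pos-^ a b))

  pairedTerms : Subset m → ℤ
  pairedTerms A = sgn A * K ^ (ρ ⊤ ∸ ρ (outside ∷ A)) + (- (+ 1) * sgn A) * K ^ (ρ ⊤ ∸ ρ (inside ∷ A))

  paired-terms : ∀ A → pairedTerms A ≡ (K - + 1) * (sgn A * + colourings A)
  paired-terms A
    rewrite rank-formula ρ isRank (outside ∷ A) | rank-formula ρ isRank (inside ∷ A) | rank-E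
          | unmarked-split (components A)
    with bad? (components A)
  ... | yes bad rewrite colourings-bad A bad =
    trans (cancel (sgn A) _) (sym (trans (cong (λ z → (K - + 1) * z) (*-zeroʳ (sgn A))) (*-zeroʳ (K - + 1))))
    where
    cancel : ∀ s p → s * p + (- (+ 1) * s) * p ≡ + 0
    cancel s p = trans (cong (λ z → s * p + z) (trans (*-assoc (- (+ 1)) s p) (-1*i≡-i (s * p)))) (+-inverseʳ (s * p))
  ... | no ¬bad =
    trans (cong₂ (λ x y → sgn A * K ^ x + (- (+ 1) * sgn A) * K ^ y) (exponent-A d f) (exponent-A+e₀ d f))
          (trans (factor (sgn A) K (K ^ f))
                 (cong (λ z → (K - + 1) * (sgn A * z)) (sym (trans (cong +_ (colourings-good (col β₀) A ¬bad)) (pos-^ k f)))))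
    where
    d f : ℕ
    d = deficit (components A)
    f = freeClasses (components A)
    β₀ : Fin n
    β₀ = proj₁ twoBoundary
    open import Data.Integer.Solver using (module +-*-Solver)
    open +-*-Solver
    factor : ∀ s K P → s * (K * P) + (- (+ 1) * s) * P ≡ (K - + 1) * (s * P)
    factor = solve 3 (λ s K P → s :* (K :* P) :+ (con (- (+ 1)) :* s) :* P := (K :- con (+ 1)) :* (s :* P)) refl

  characteristic-polynomial : charPolyAt (suc m) ρ k ≡ (K - + 1) * (+ numColorings N k col)
  characteristic-polynomial = begin
    charPolyAt (suc m) ρ k
      ≡⟨ sym (sumSubsets-+ m (λ A → sgn A * K ^ (ρ ⊤ ∸ ρ (outside ∷ A)))
                             (λ A → (- (+ 1) * sgn A) * K ^ (ρ ⊤ ∸ ρ (inside ∷ A)))) ⟩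
    sumSubsets m pairedTerms
      ≡⟨ sumSubsets-cong m _ _ paired-terms ⟩
    sumSubsets m (λ A → (K - + 1) * (sgn A * + colourings A))
      ≡⟨ sumSubsets-* m (K - + 1) (λ A → sgn A * + colourings A) ⟩
    (K - + 1) * sumSubsets m (λ A → sgn A * + colourings A)
      ≡⟨ cong ((K - + 1) *_) (sym (inclusion-exclusion (allVecs k n))) ⟩
    (K - + 1) * (+ numColorings N k col) ∎
    where open ≡-Reasoning

open import Data.Integer using (+_; _-_; _*_)

-- Proposition 4.2: for k ≥ |B| and an injective colouring col of B,
-- χ_M(N)(k) = (k − 1) · #{proper k-colourings of Γ extending col on B}.
proposition4p2 : ∀ {c ℓ : Level} (N : Network) (F : Field c ℓ)
    (u : Fin (Network.n N) → Field.Carrier F) →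
    (∀ i j → Network.isB N i ≡ true → Network.isB N j ≡ true → Field._≈_ F (u i) (u j) → i ≡ j) →
    (ρ : Subset (suc (Network.m N)) → ℕ) →
    (∀ S → DirichletMatroid.IsRank N F u S (ρ S)) →
    (k : ℕ) → ∣ Bset N ∣ ≤ k →
    (col : Fin (Network.n N) → Fin k) →
    (∀ i j → Network.isB N i ≡ true → Network.isB N j ≡ true → col i ≡ col j → i ≡ j) →
    charPolyAt (suc (Network.m N)) ρ k ≡ (+ k - + 1) * (+ numColorings N k col)
proposition4p2 N F u u-injective ρ isRank k _ col col-injective =
  CharacteristicPolynomial.characteristic-polynomial N F u u-injective ρ isRank k col col-injective
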